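{- Let $G$ be a finite abelian group having exactly $f>0$ involutions (elements of order $2$). Suppose there exists a $(G,\{2^f,3^e\},3,1)$-difference family for some integer $e\geq 0$. Then: (1) $f=2^m-1$ for some integer $m\geq 1$; (2) $|G|=2^{m+\ell}d$ for some odd integer $d\geq 1$ and some integer $\ell\geq 0$; (3) $G\cong\mathbb Z_{2^{\alpha_1}}\times\cdots\times\mathbb Z_{2^{\alpha_m}}\times H$ for some abelian group $H$ of order $d$ and some positive integers $\alpha_1,\dots,\alpha_m$ with $\alpha_1+\cdots+\alpha_m=m+\ell$; (4) if $3\mid d$, then $e\equiv(-1)^m\pmod 3$; (5) $d\equiv(-1)^\ell\pmod 6$, or $m$ is even and $d\equiv 3\pmod 6$, or $m$ is odd and $d\equiv 9\pmod{18}$.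
   Context: Let $(G,+)$ be a finite abelian group. A partial spread of $G$ is a family $\Sigma$ of subgroups of $G$ whose members pairwise intersect trivially; it has type $\{n_1^{f_1},\dots,n_t^{f_t}\}$ if it consists of exactly $f_i$ subgroups of order $n_i$ for each $i$ (and no others). For a triple $T=\{a,b,c\}$ of three distinct elements of $G$, $\Delta T$ is the multiset $\{\pm(a-b),\pm(a-c),\pm(b-c)\}$, and for a set $\mathcal T$ of triples, $\Delta\mathcal T$ is the multiset union of the $\Delta T$. For a partial spread $\Sigma$, a $(G,\Sigma,3,1)$-difference family is a set $\mathcal T$ of triples of $G$ with $\Delta\mathcal T=G\setminus\bigcup_{S\in\Sigma}S$ as multisets (each element outside the union occurs exactly once, elements of the union do not occur). A $(G,\tau,3,1)$-difference family is a $(G,\Sigma,3,1)$-difference family for some partial spread $\Sigma$ of $G$ of type $\tau$. -}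

module Defs where

open import Level using (0ℓ)
open import Data.Nat as ℕ using (ℕ; zero; suc; NonZero; _^_)
open import Data.Nat.Properties using (m^n≢0)
open import Data.Nat.DivMod using (_mod_)
open import Data.Fin as Fin using (Fin; toℕ)
open import Data.Fin.Properties as FinP using ()
open import Data.List using (List; []; _∷_; length; filter; map; concatMap; allFin; lookup)
open import Data.List.Membership.Propositional using (_∈_)
open import Data.List.Relation.Unary.Unique.Propositional using (Unique)
open import Data.List.Relation.Unary.Any using (Any)
open import Data.List.Relation.Unary.All using (All)
open import Data.Product using (_×_; _,_)
open import Data.Sum using (_⊎_)
open import Data.Unit using (⊤; tt)
open import Function using (_∘_)
open import Function.Bundles using (_↔_; Inverse)
open import Relation.Nullary using (¬_; Dec; yes; no)
open import Relation.Binary.PropositionalEquality using (_≡_; _≢_; refl; cong; sym; trans)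
open import Algebra.Core using (Op₁; Op₂)
open import Algebra.Structures using (IsAbelianGroup)

-- Finite abelian groups (equality is propositional equality; finiteness
-- is witnessed by a bijection with Fin order, so |G| = order).

record FinAbGroup : Set₁ where
  infixl 6 _+_ _-_
  field
    Carrier        : Set
    _+_            : Op₂ Carrier
    0#             : Carrier
    -_             : Op₁ Carrier
    isAbelianGroup : IsAbelianGroup _≡_ _+_ 0# -_
    order          : ℕ
    enum           : Carrier ↔ Fin order

  _-_ : Op₂ Carrier
  x - y = x + (- y)

  _≟_ : (x y : Carrier) → Dec (x ≡ y)
  x ≟ y with Inverse.to enum x Fin.≟ Inverse.to enum y
  ... | yes p = yes (trans (sym (Inverse.inverseʳ enum refl))
                     (trans (cong (Inverse.from enum) p) (Inverse.inverseʳ enum refl)))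
  ... | no ¬p = no (λ q → ¬p (cong (Inverse.to enum) q))

  elements : List Carrier
  elements = map (Inverse.from enum) (allFin order)

  IsInvolution : Carrier → Set
  IsInvolution x = x ≢ 0# × x + x ≡ 0#

  isInvolution? : (x : Carrier) → Dec (IsInvolution x)
  isInvolution? x with x ≟ 0# | (x + x) ≟ 0#
  ... | yes p | _     = no (λ (q , _) → q p)
  ... | no ¬p | yes q = yes (¬p , q)
  ... | no _  | no ¬q = no (λ (_ , q) → ¬q q)

  numInvolutions : ℕ
  numInvolutions = length (filter isInvolution? elements)

  count : Carrier → List Carrier → ℕ
  count x xs = length (filter (x ≟_) xs)

module _ (G : FinAbGroup) where
  open FinAbGroup G

  record Subgroup : Set where
    field
      elems   : List Carrier
      unique  : Unique elems
      has-0   : 0# ∈ elems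
      closed+ : ∀ {x y} → x ∈ elems → y ∈ elems → (x + y) ∈ elems
      closed- : ∀ {x} → x ∈ elems → (- x) ∈ elems

    ord : ℕ
    ord = length elems

  open Subgroup

  IsPartialSpread : List Subgroup → Set
  IsPartialSpread Σ =
    ∀ (i j : Fin (length Σ)) → i ≢ j →
      ∀ x → x ∈ elems (lookup Σ i) → x ∈ elems (lookup Σ j) → x ≡ 0#

  HasType23 : List Subgroup → ℕ → ℕ → Set
  HasType23 Σ f e =
    All (λ S → ord S ≡ 2 ⊎ ord S ≡ 3) Σ
    × length (filter (λ S → ord S ℕ.≟ 2) Σ) ≡ f
    × length (filter (λ S → ord S ℕ.≟ 3) Σ) ≡ e

  InUnion : List Subgroup → Carrier → Set
  InUnion Σ x = Any (λ S → x ∈ elems S) Σ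

  record Triple : Set where
    constructor triple
    field
      a b c : Carrier
      a≢b   : a ≢ b
      a≢c   : a ≢ c
      b≢c   : b ≢ c

  ΔTriple : Triple → List Carrier
  ΔTriple (triple a b c _ _ _) =
    (a - b) ∷ (b - a) ∷ (a - c) ∷ (c - a) ∷ (b - c) ∷ (c - b) ∷ []

  ΔFamily : List Triple → List Carrier
  ΔFamily 𝒯 = concatMap ΔTriple 𝒯

  -- (G, Σ, 3, 1)-difference family: Δ𝒯 = G ∖ ⋃Σ as multisets
  IsDiffFamily : List Subgroup → List Triple → Set
  IsDiffFamily Σ 𝒯 =
    ∀ x → (InUnion Σ x → count x (ΔFamily 𝒯) ≡ 0)
        × (¬ InUnion Σ x → count x (ΔFamily 𝒯) ≡ 1)

  HasDiffFamily23 : ℕ → ℕ → Set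
  HasDiffFamily23 f e =
    Data.Product.Σ (List Subgroup) λ Σ → Data.Product.Σ (List Triple) λ 𝒯 →
      IsPartialSpread Σ × HasType23 Σ f e × IsDiffFamily Σ 𝒯

addMod : (n : ℕ) .{{_ : NonZero n}} → Fin n → Fin n → Fin n
addMod n x y = (toℕ x ℕ.+ toℕ y) mod n

Cyc2Prod : List ℕ → Set
Cyc2Prod []       = ⊤
Cyc2Prod (α ∷ αs) = Fin (2 ^ α) × Cyc2Prod αs

addCyc2 : (αs : List ℕ) → Cyc2Prod αs → Cyc2Prod αs → Cyc2Prod αs
addCyc2 []       _        _        = tt
addCyc2 (α ∷ αs) (x , xs) (y , ys) =
  addMod (2 ^ α) {{m^n≢0 2 α}} x y , addCyc2 αs xs ys

record IsoToCyc2Prod (G : FinAbGroup) (αs : List ℕ) (H : FinAbGroup) : Set where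
  private
    module G = FinAbGroup G
    module H = FinAbGroup H
  field
    φ     : G.Carrier ↔ (Cyc2Prod αs × H.Carrier)
    φ-hom : ∀ x y →
      Inverse.to φ (x G.+ y) ≡
        (addCyc2 αs (Data.Product.proj₁ (Inverse.to φ x)) (Data.Product.proj₁ (Inverse.to φ y))
        , Data.Product.proj₂ (Inverse.to φ x) H.+ Data.Product.proj₂ (Inverse.to φ y))

module Submission where

-- Count differences: the union of the spread has 1 + f + 2e elements and Δ𝒯 lists every other
-- element exactly once, so |G| = 1 + f + 2e + 6|𝒯|.  Write G = P ⊕ H with P the 2-part and H the
-- odd part.  A basis of P, built greedily downwards through the subgroups 2^j D G (D the odd part of
-- |G|!, which kills G), gives P ≅ Z_{2^α₁} × ⋯ × Z_{2^αₘ}, so the elements of order ≤ 2 number 2^m = 1 + f.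
-- Pairing x with - x shows that |H| = d is odd.  The members of order 3 of the spread lie in H, so by
-- Lagrange e > 0 forces 3 ∣ d and e ≥ 2 forces 9 ∣ d; reducing 2^(m+ℓ) d = 2^m + 2e + 6|𝒯| modulo 3,
-- where 2 ≡ -1, yields (4) and (5).

open import Defs
open import Level using (0ℓ)
open import Algebra.Bundles using (AbelianGroup)
open import Axiom.UniquenessOfIdentityProofs.WithK using (uip)
open import Data.Empty using (⊥; ⊥-elim)
open import Data.Fin as Fin using (Fin; toℕ)
open import Data.Fin.Permutation using (↔⇒≡)
import Data.Fin.Properties as Finₚ
open import Data.List
  using (List; []; _∷_; length; filter; map; foldr; lookup; allFin; concatMap; upTo; _++_; cartesianProduct)
import Data.List.Properties as Listₚ
open import Data.List.Membership.Propositional using (_∈_; find; lose)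
import Data.List.Membership.Propositional.Properties as ∈ₚ
open import Data.List.Membership.Propositional.Properties.WithK using (unique∧set⇒bag; unique⇒irrelevant)
open import Data.List.Relation.Binary.BagAndSetEquality using (∼bag⇒↭)
open import Data.List.Relation.Binary.Permutation.Propositional using (_↭_; ↭⇒↭ₛ)
open import Data.List.Relation.Binary.Permutation.Propositional.Properties using (↭-length)
open import Data.List.Relation.Unary.All as All using (All; []; _∷_)
import Data.List.Relation.Unary.All.Properties as Allₚ
open import Data.List.Relation.Unary.Any as Any using (Any; here; there; any?)
open import Data.List.Relation.Unary.Any.Properties using (lookup-index)
open import Data.List.Relation.Unary.Unique.Propositional using (Unique; []; _∷_)
import Data.List.Relation.Unary.Unique.Propositional.Properties as Uniqueₚ
open import Data.Nat as ℕ using (ℕ; zero; suc; _∸_; _^_; _≤_; _<_; z≤n; s≤s; NonZero; _%_; _/_; _!)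
import Data.Nat.Properties as ℕₚ
open import Data.Nat.Induction using (<-wellFounded)
open import Data.Nat.Tactic.RingSolver using (solve-∀)
open import Induction.WellFounded using (Acc; acc)
open import Data.Nat.Divisibility as ℕ∣ using (_∣_; divides)
open import Data.Nat.DivMod
  using (_mod_; m≡m%n+[m/n]*n; m%n<n; m/n*n≡m; m<n⇒m%n≡m; %-distribˡ-+; %-distribˡ-*; [m+kn]%n≡m%n; m∣n⇒o%n%m≡o%m)
open import Data.Nat.ListAction using (sum)
open import Data.Integer as ℤ using (1ℤ; -1ℤ)
open import Data.Integer.Divisibility as ℤD using ()
open import Data.Product using (Σ; ∃-syntax; Σ-syntax; _×_; _,_; proj₁; proj₂)
open import Data.Product.Function.NonDependent.Propositional using (_×-↔_)
open import Data.Sum using (_⊎_; inj₁; inj₂)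
open import Data.Unit using (⊤; tt)
open import Function using (_∘_; id; case_of_)
open import Function.Bundles using (_↔_; Inverse; Injection; mk↔ₛ′; mk⇔)
open import Function.Properties.Inverse using (↔⇒↣)
open import Function.Construct.Composition using (_↔-∘_)
open import Function.Construct.Identity using (↔-id)
open import Function.Construct.Symmetry using (↔-sym)
open import Relation.Nullary using (¬_; yes; no; ¬?)
open import Relation.Nullary.Decidable using (_×-dec_; _⊎-dec_; map′)
open import Relation.Unary using (Decidable)
open import Relation.Binary.PropositionalEquality

module _ {A : Set} where

  unique∧set⇒length≡ : {xs ys : List A} → Unique xs → Unique ys →
    (∀ {x} → x ∈ xs → x ∈ ys) → (∀ {x} → x ∈ ys → x ∈ xs) → length xs ≡ length ys
  unique∧set⇒length≡ uxs uys xs⊆ys ys⊆xs =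
    ↭-length (∼bag⇒↭ (unique∧set⇒bag uxs uys (mk⇔ xs⊆ys ys⊆xs)))

  length-filter-split : {P Q : A → Set} (P? : Decidable P) (Q? : Decidable Q) (xs : List A) →
    length (filter P? xs)
      ≡ length (filter (λ x → P? x ×-dec Q? x) xs) ℕ.+ length (filter (λ x → P? x ×-dec ¬? (Q? x)) xs)
  length-filter-split P? Q? [] = refl
  length-filter-split P? Q? (x ∷ xs) with P? x | Q? x
  ... | yes _ | yes _ = cong suc (length-filter-split P? Q? xs)
  ... | yes _ | no _  = trans (cong suc (length-filter-split P? Q? xs)) (sym (ℕₚ.+-suc _ _))
  ... | no _  | yes _ = length-filter-split P? Q? xs
  ... | no _  | no _  = length-filter-split P? Q? xs

  length-filter-¬ : {Q : A → Set} (Q? : Decidable Q) (xs : List A) →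
    length xs ≡ length (filter Q? xs) ℕ.+ length (filter (¬? ∘ Q?) xs)
  length-filter-¬ Q? [] = refl
  length-filter-¬ Q? (x ∷ xs) with Q? x
  ... | yes _ = cong suc (length-filter-¬ Q? xs)
  ... | no _  = trans (cong suc (length-filter-¬ Q? xs)) (sym (ℕₚ.+-suc _ _))

  length-filter-≐ : {P Q : A → Set} (P? : Decidable P) (Q? : Decidable Q) (xs : List A) →
    (∀ {x} → P x → Q x) → (∀ {x} → Q x → P x) → length (filter P? xs) ≡ length (filter Q? xs)
  length-filter-≐ P? Q? xs P⊆Q Q⊆P = cong length (Listₚ.filter-≐ P? Q? (P⊆Q , Q⊆P) xs)

  index-filter : {P : A → Set} (P? : Decidable P) (xs : List A) →
    1 ≤ length (filter P? xs) → ∃[ i ] P (lookup xs i)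
  index-filter P? (x ∷ xs) h with P? x
  ... | yes px = Fin.zero , px
  ... | no _ with index-filter P? xs h
  ...   | i , pi = Fin.suc i , pi

  distinct-indices-filter : {P : A → Set} (P? : Decidable P) (xs : List A) →
    2 ≤ length (filter P? xs) → ∃[ i ] ∃[ j ] (i ≢ j × P (lookup xs i) × P (lookup xs j))
  distinct-indices-filter P? (x ∷ xs) h with P? x
  ... | yes px with index-filter P? xs (ℕₚ.≤-pred h)
  ...   | j , pj = Fin.zero , Fin.suc j , (λ ()) , px , pj
  distinct-indices-filter P? (x ∷ xs) h | no _ with distinct-indices-filter P? xs h
  ...   | i , j , i≢j , pi , pj = Fin.suc i , Fin.suc j , i≢j ∘ Finₚ.suc-injective , pi , pj

  Σ-≡-irrelevant : {Q : A → Set} → (∀ {x} (p q : Q x) → p ≡ q) →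
    ∀ {x y} {p : Q x} {q : Q y} → x ≡ y → (x , p) ≡ (y , q)
  Σ-≡-irrelevant irrelevant {x} refl = cong (x ,_) (irrelevant _ _)

  index-∈-lookup : (xs : List A) (i : Fin (length xs)) → Any.index (∈ₚ.∈-lookup {xs = xs} i) ≡ i
  index-∈-lookup (x ∷ xs) Fin.zero = refl
  index-∈-lookup (x ∷ xs) (Fin.suc i) = cong Fin.suc (index-∈-lookup xs i)

  Σ↔Fin-length : {Q : A → Set} (xs : List A) → Unique xs →
    (∀ {x} → x ∈ xs → Q x) → (∀ {x} → Q x → x ∈ xs) → (∀ {x} (p q : Q x) → p ≡ q) →
    Σ A Q ↔ Fin (length xs)
  Σ↔Fin-length {Q} xs uxs sound complete irrelevant = mk↔ₛ′ to from to∘from from∘to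
    where
    to : Σ A Q → Fin (length xs)
    to (x , q) = Any.index (complete q)
    from : Fin (length xs) → Σ A Q
    from i = lookup xs i , sound (∈ₚ.∈-lookup i)
    to∘from : ∀ i → to (from i) ≡ i
    to∘from i = trans (cong Any.index (unique⇒irrelevant uxs _ _)) (index-∈-lookup xs i)
    from∘to : ∀ p → from (to p) ≡ p
    from∘to (x , q) = Σ-≡-irrelevant irrelevant (sym (lookup-index (complete q)))

Odd : ℕ → Set
Odd n = ∃[ k ] n ≡ suc (2 ℕ.* k)

parity : ∀ n → ∃[ k ] (n ≡ 2 ℕ.* k ⊎ n ≡ suc (2 ℕ.* k))
parity zero = 0 , inj₁ refl
parity (suc n) with parity n
... | k , inj₁ refl = k , inj₂ refl
... | k , inj₂ refl = suc k , inj₁ (cong suc (sym (ℕₚ.+-suc k (k ℕ.+ 0))))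

2-adic : ∀ n → 1 ≤ n → ∃[ a ] ∃[ d ] (Odd d × n ≡ 2 ^ a ℕ.* d)
2-adic n = go n (<-wellFounded n)
  where
  go : ∀ n → Acc _<_ n → 1 ≤ n → ∃[ a ] ∃[ d ] (Odd d × n ≡ 2 ^ a ℕ.* d)
  go n (acc rec) 1≤n with parity n
  ... | k , inj₂ refl = 0 , n , (k , refl) , sym (ℕₚ.*-identityˡ n)
  go .(2 ℕ.* suc k) (acc rec) _ | suc k , inj₁ refl
    with go (suc k) (rec (ℕₚ.m<m+n (suc k) (s≤s z≤n))) (s≤s z≤n)
  ... | a , d , d-odd , k+1≡2^a*d =
    suc a , d , d-odd , trans (cong (2 ℕ.*_) k+1≡2^a*d) (sym (ℕₚ.*-assoc 2 (2 ^ a) d))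

suc^≡1+* : ∀ d a → ∃[ q ] (suc d ^ a ≡ 1 ℕ.+ d ℕ.* q)
suc^≡1+* d zero = 0 , cong suc (sym (ℕₚ.*-zeroʳ d))
suc^≡1+* d (suc a) with suc^≡1+* d a
... | q , eq = 1 ℕ.+ q ℕ.+ d ℕ.* q , trans (cong (suc d ℕ.*_) eq) (expand d q)
  where
  expand : ∀ d q → suc d ℕ.* (1 ℕ.+ d ℕ.* q) ≡ 1 ℕ.+ d ℕ.* (1 ℕ.+ q ℕ.+ d ℕ.* q)
  expand = solve-∀

^-monoˡ-∣ : ∀ {m n} k → m ∣ n → m ^ k ∣ n ^ k
^-monoˡ-∣ zero    _   = ℕ∣.∣-refl
^-monoˡ-∣ (suc k) m∣n = ℕ∣.*-pres-∣ m∣n (^-monoˡ-∣ k m∣n)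

∣+∸⇒≡ : ∀ {M a b} → a < M → b < M → M ∣ a ℕ.+ (M ∸ b) → a ≡ b
∣+∸⇒≡ {M} {a} {b} a<M b<M (divides q s≡qM) =
  ℕₚ.+-cancelʳ-≡ (M ∸ b) a b (trans (s≡M q s≡qM) (sym (ℕₚ.m+[n∸m]≡n (ℕₚ.<⇒≤ b<M))))
  where
  s = a ℕ.+ (M ∸ b)
  s≡M : ∀ q → s ≡ q ℕ.* M → s ≡ M
  s≡M zero s≡0 = ⊥-elim (ℕₚ.<⇒≢ (ℕₚ.≤-trans (ℕₚ.m<n⇒0<n∸m b<M) (ℕₚ.m≤n+m (M ∸ b) a)) (sym s≡0))
  s≡M (suc zero) s≡M+0 = trans s≡M+0 (ℕₚ.+-identityʳ M)
  s≡M (suc (suc q)) s≡2M+ = ⊥-elim (ℕₚ.<⇒≱ (ℕₚ.+-mono-<-≤ a<M (ℕₚ.m∸n≤m M b))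
    (subst (M ℕ.+ M ≤_) (sym s≡2M+) (ℕₚ.+-monoʳ-≤ M (ℕₚ.m≤m+n M (q ℕ.* M)))))

2^∣⇒2∣ : ∀ {β k} → 1 ≤ β → 2 ^ β ∣ k → 2 ∣ k
2^∣⇒2∣ {suc β} _ = ℕ∣.∣-trans (ℕ∣.m∣m*n (2 ^ β))

Fin-∣+∸⇒≡ : ∀ {n} (i j : Fin n) → n ∣ toℕ i ℕ.+ (n ∸ toℕ j) → i ≡ j
Fin-∣+∸⇒≡ i j n∣ = Finₚ.toℕ-injective (∣+∸⇒≡ (Finₚ.toℕ<n i) (Finₚ.toℕ<n j) n∣)

residue-3 : ∀ k → k % 3 ≡ 0 ⊎ k % 3 ≡ 1 ⊎ k % 3 ≡ 2
residue-3 k with k % 3 | m%n<n k 3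
... | 0 | _ = inj₁ refl
... | 1 | _ = inj₂ (inj₁ refl)
... | 2 | _ = inj₂ (inj₂ refl)
... | suc (suc (suc _)) | s≤s (s≤s (s≤s ()))

length≤sum : ∀ αs → All (1 ≤_) αs → length αs ≤ sum αs
length≤sum []       []         = z≤n
length≤sum (α ∷ αs) (1≤α ∷ ps) = ℕₚ.+-mono-≤ 1≤α (length≤sum αs ps)

Cyc2Prod↔Fin : ∀ αs → Cyc2Prod αs ↔ Fin (2 ^ sum αs)
Cyc2Prod↔Fin []       = ↔-sym Finₚ.1↔⊤
Cyc2Prod↔Fin (α ∷ αs) = subst (λ n → Cyc2Prod (α ∷ αs) ↔ Fin n) (sym (ℕₚ.^-distribˡ-+-* 2 α (sum αs)))
  (↔-sym Finₚ.*↔× ↔-∘ (↔-id (Fin (2 ^ α)) ×-↔ Cyc2Prod↔Fin αs))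

infix 7 _mod2^_

_mod2^_ : ℕ → (β : ℕ) → Fin (2 ^ β)
m mod2^ β = (m mod (2 ^ β)) {{ℕₚ.m^n≢0 2 β}}

toℕ-mod2^ : ∀ {m} β → m < 2 ^ β → toℕ (m mod2^ β) ≡ m
toℕ-mod2^ {m} β m<2^β = trans (Finₚ.toℕ-fromℕ< (m%n<n m (2 ^ β))) (m<n⇒m%n≡m m<2^β)
  where instance _ = ℕₚ.m^n≢0 2 β

zeros : ∀ αs → Cyc2Prod αs
zeros []       = tt
zeros (α ∷ αs) = 0 mod2^ α , zeros αs

half : ∀ β → Fin (2 ^ suc β)
half β = 2 ^ β mod2^ suc β

toℕ-half : ∀ β → toℕ (half β) ≡ 2 ^ β
toℕ-half β = toℕ-mod2^ (suc β) (ℕₚ.^-monoʳ-< 2 (s≤s (s≤s z≤n)) (ℕₚ.n<1+n β))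

halves : ∀ αs → All (1 ≤_) αs → List (Cyc2Prod αs)
halves []           []           = tt ∷ []
halves (suc β ∷ αs) (s≤s _ ∷ ps) = map (0 mod2^ suc β ,_) (halves αs ps) ++ map (half β ,_) (halves αs ps)

length-halves : ∀ αs ps → length (halves αs ps) ≡ 2 ^ length αs
length-halves []           []           = refl
length-halves (suc β ∷ αs) (s≤s _ ∷ ps) = begin
  length (map (0 mod2^ suc β ,_) hs ++ map (half β ,_) hs)
    ≡⟨ Listₚ.length-++ (map (0 mod2^ suc β ,_) hs) ⟩
  length (map (0 mod2^ suc β ,_) hs) ℕ.+ length (map (half β ,_) hs)
    ≡⟨ cong₂ ℕ._+_ (Listₚ.length-map _ hs) (Listₚ.length-map _ hs) ⟩
  length hs ℕ.+ length hs
    ≡⟨ cong (λ n → n ℕ.+ n) (length-halves αs ps) ⟩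
  2 ^ length αs ℕ.+ 2 ^ length αs
    ≡⟨ cong (2 ^ length αs ℕ.+_) (sym (ℕₚ.+-identityʳ _)) ⟩
  2 ^ suc (length αs) ∎
  where
  open ≡-Reasoning
  hs = halves αs ps

halves-unique : ∀ αs ps → Unique (halves αs ps)
halves-unique []           []           = [] ∷ []
halves-unique (suc β ∷ αs) (s≤s _ ∷ ps) =
  Uniqueₚ.++⁺ (Uniqueₚ.map⁺ (cong proj₂) (halves-unique αs ps)) (Uniqueₚ.map⁺ (cong proj₂) (halves-unique αs ps))
    (λ (c∈₀ , c∈₁) → disjoint c∈₀ c∈₁)
  where
  0≢half : 0 mod2^ suc β ≢ half β
  0≢half eq = ℕₚ.<⇒≢ (ℕₚ.m^n>0 2 β)
    (trans (sym (toℕ-mod2^ (suc β) (ℕₚ.m^n>0 2 (suc β)))) (trans (cong toℕ eq) (toℕ-half β)))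
  disjoint : ∀ {c} → c ∈ map (0 mod2^ suc β ,_) (halves αs ps) → c ∈ map (half β ,_) (halves αs ps) → ⊥
  disjoint c∈₀ c∈₁ with ∈ₚ.∈-map⁻ (0 mod2^ suc β ,_) c∈₀ | ∈ₚ.∈-map⁻ (half β ,_) c∈₁
  ... | _ , _ , refl | _ , _ , eq = 0≢half (cong proj₁ eq)

double≡0⇒0∨half : ∀ β (x : Fin (2 ^ suc β)) →
  (toℕ x ℕ.+ toℕ x) mod2^ suc β ≡ 0 mod2^ suc β → x ≡ 0 mod2^ suc β ⊎ x ≡ half β
double≡0⇒0∨half β x eq
  with ℕ∣.*-cancelˡ-∣ 2 (subst (2 ℕ.* 2 ^ β ∣_) (cong (toℕ x ℕ.+_) (sym (ℕₚ.+-identityʳ (toℕ x))))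
                        (ℕ∣.m%n≡0⇒n∣m _ (2 ^ suc β) x+x%2^[1+β]≡0))
  where
  instance _ = ℕₚ.m^n≢0 2 (suc β)
  x+x%2^[1+β]≡0 : (toℕ x ℕ.+ toℕ x) % 2 ^ suc β ≡ 0
  x+x%2^[1+β]≡0 = trans (sym (Finₚ.toℕ-fromℕ< (m%n<n _ (2 ^ suc β))))
    (trans (cong toℕ eq) (toℕ-mod2^ (suc β) (ℕₚ.m^n>0 2 (suc β))))
... | divides zero x≡0 =
  inj₁ (Finₚ.toℕ-injective (trans x≡0 (sym (toℕ-mod2^ (suc β) (ℕₚ.m^n>0 2 (suc β))))))
... | divides (suc zero) x≡2^β =
  inj₂ (Finₚ.toℕ-injective (trans x≡2^β (trans (ℕₚ.+-identityʳ _) (sym (toℕ-half β)))))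
... | divides (suc (suc k)) x≡[2+k]2^β = ⊥-elim (ℕₚ.<⇒≱ (Finₚ.toℕ<n x)
  (subst (2 ^ suc β ≤_) (sym x≡[2+k]2^β) (ℕₚ.+-monoʳ-≤ (2 ^ β) (ℕₚ.+-monoʳ-≤ (2 ^ β) z≤n))))

double≡zeros⇒∈halves : ∀ αs ps (c : Cyc2Prod αs) → addCyc2 αs c c ≡ zeros αs → c ∈ halves αs ps
double≡zeros⇒∈halves []           []           tt       _  = here refl
double≡zeros⇒∈halves (suc β ∷ αs) (s≤s _ ∷ ps) (x , cs) eq with double≡0⇒0∨half β x (cong proj₁ eq)
... | inj₁ refl = ∈ₚ.∈-++⁺ˡ (∈ₚ.∈-map⁺ (0 mod2^ suc β ,_) (double≡zeros⇒∈halves αs ps cs (cong proj₂ eq)))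
... | inj₂ refl = ∈ₚ.∈-++⁺ʳ (map (0 mod2^ suc β ,_) (halves αs ps))
                   (∈ₚ.∈-map⁺ (half β ,_) (double≡zeros⇒∈halves αs ps cs (cong proj₂ eq)))

module FinAbGroupTheory (G : FinAbGroup) where

  open FinAbGroup G

  open import Data.List.Membership.DecPropositional _≟_ using (_∈?_)
  open import Data.List.Relation.Binary.Permutation.Setoid.Properties (setoid Carrier) using (foldr-commMonoid)

  abelianGroup : AbelianGroup 0ℓ 0ℓ
  abelianGroup = record
    { Carrier = Carrier ; _≈_ = _≡_ ; _∙_ = _+_ ; ε = 0# ; _⁻¹ = -_ ; isAbelianGroup = isAbelianGroup }

  open AbelianGroup abelianGroup public
    using (assoc; comm; identityˡ; identityʳ; inverseˡ; inverseʳ)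
  open import Algebra.Properties.AbelianGroup abelianGroup public
    using (∙-cancelˡ; ∙-cancelʳ; inverseʳ-unique; ⁻¹-involutive; ⁻¹-injective; ε⁻¹≈ε; ⁻¹-∙-comm; ⁻¹-anti-homo‿-;
           xyx⁻¹≈y; x∙y⁻¹≈ε⇒x≈y; x≈y⇒x∙y⁻¹≈ε)
  open import Algebra.Properties.CommutativeSemigroup (AbelianGroup.commutativeSemigroup abelianGroup) public
    using (interchange)
  open import Algebra.Properties.CommutativeMonoid.Mult (AbelianGroup.commutativeMonoid abelianGroup) public
    using (×-homo-1; ×-homo-+; ×-assocˡ; ×-distrib-+)
    renaming (_×_ to _·_)

  x-y+y≡x : ∀ x y → (x - y) + y ≡ x
  x-y+y≡x x y = trans (assoc x (- y) y) (trans (cong (x +_) (inverseˡ y)) (identityʳ x))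

  x-y+[y-z]≡x-z : ∀ x y z → (x - y) + (y - z) ≡ x - z
  x-y+[y-z]≡x-z x y z = begin
    (x - y) + (y - z)     ≡⟨ assoc x (- y) (y - z) ⟩
    x + (- y + (y - z))   ≡⟨ cong (x +_) (sym (assoc (- y) y (- z))) ⟩
    x + ((- y + y) - z)   ≡⟨ cong (λ t → x + (t - z)) (inverseˡ y) ⟩
    x + (0# - z)          ≡⟨ cong (x +_) (identityˡ (- z)) ⟩
    x - z                 ∎
    where open ≡-Reasoning

  +≡+⇒-≡- : ∀ {x y z w} → x + y ≡ z + w → x - z ≡ w - y
  +≡+⇒-≡- {x} {y} {z} {w} x+y≡z+w = begin
    x - z                     ≡⟨ sym (identityʳ _) ⟩
    (x - z) + 0#              ≡⟨ cong ((x - z) +_) (sym (inverseʳ y)) ⟩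
    (x - z) + (y - y)         ≡⟨ interchange x (- z) y (- y) ⟩
    (x + y) + (- z - y)       ≡⟨ cong (_+ (- z - y)) x+y≡z+w ⟩
    (z + w) + (- z - y)       ≡⟨ interchange z w (- z) (- y) ⟩
    (z - z) + (w - y)         ≡⟨ cong (_+ (w - y)) (inverseʳ z) ⟩
    0# + (w - y)              ≡⟨ identityˡ _ ⟩
    w - y                     ∎
    where open ≡-Reasoning

  ·-zeroʳ : ∀ n → n · 0# ≡ 0#
  ·-zeroʳ zero    = refl
  ·-zeroʳ (suc n) = trans (identityˡ _) (·-zeroʳ n)

  ·-neg : ∀ n x → n · (- x) ≡ - (n · x)
  ·-neg zero    x = sym ε⁻¹≈ε
  ·-neg (suc n) x = trans (cong (- x +_) (·-neg n x)) (⁻¹-∙-comm x (n · x))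

  ·-- : ∀ n x y → n · (x - y) ≡ n · x - n · y
  ·-- n x y = trans (×-distrib-+ x (- y) n) (cong (n · x +_) (·-neg n y))

  ·≡·⇒·-≡0 : ∀ {n x y} → n · x ≡ n · y → n · (x - y) ≡ 0#
  ·≡·⇒·-≡0 {n} {x} {y} nx≡ny = trans (·-- n x y) (x≈y⇒x∙y⁻¹≈ε nx≡ny)

  ∸·≡- : ∀ {n x} b → n · x ≡ 0# → b ≤ n → (n ∸ b) · x ≡ - (b · x)
  ∸·≡- {n} {x} b nx≡0 b≤n = inverseʳ-unique _ _ (trans (comm _ _)
    (trans (sym (×-homo-+ x (n ∸ b) b)) (trans (cong (_· x) (ℕₚ.m∸n+n≡m b≤n)) nx≡0)))

  +∸·≡- : ∀ {n x} i j → n · x ≡ 0# → j ≤ n → (i ℕ.+ (n ∸ j)) · x ≡ i · x - j · x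
  +∸·≡- {n} {x} i j nx≡0 j≤n = trans (×-homo-+ x i (n ∸ j)) (cong (i · x +_) (∸·≡- j nx≡0 j≤n))

  ·-assoc : ∀ m n x → (m ℕ.* n) · x ≡ m · (n · x)
  ·-assoc m n x = sym (×-assocˡ x m n)

  ·-comm : ∀ m n x → m · (n · x) ≡ n · (m · x)
  ·-comm m n x = trans (sym (·-assoc m n x)) (trans (cong (_· x) (ℕₚ.*-comm m n)) (·-assoc n m x))

  ·≡0-∣ : ∀ {m n x} → m ∣ n → m · x ≡ 0# → n · x ≡ 0#
  ·≡0-∣ {m} {x = x} (divides k refl) mx≡0 =
    trans (·-assoc k m x) (trans (cong (k ·_) mx≡0) (·-zeroʳ k))

  ·-mod : ∀ {m x} .{{_ : NonZero m}} k → m · x ≡ 0# → k · x ≡ (k % m) · x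
  ·-mod {m} {x} k mx≡0 = begin
    k · x                                ≡⟨ cong (_· x) (m≡m%n+[m/n]*n k m) ⟩
    (k % m ℕ.+ (k / m) ℕ.* m) · x        ≡⟨ ×-homo-+ x (k % m) _ ⟩
    (k % m) · x + ((k / m) ℕ.* m) · x    ≡⟨ cong ((k % m) · x +_) (·≡0-∣ (ℕ∣.n∣m*n (k / m)) mx≡0) ⟩
    (k % m) · x + 0#                     ≡⟨ identityʳ _ ⟩
    (k % m) · x                          ∎
    where open ≡-Reasoning

  ∈-elements : ∀ x → x ∈ elements
  ∈-elements x = subst (_∈ elements) (Inverse.strictlyInverseʳ enum x)
    (∈ₚ.∈-map⁺ (Inverse.from enum) (∈ₚ.∈-allFin (Inverse.to enum x)))

  elements-unique : Unique elements
  elements-unique = Uniqueₚ.map⁺ (Injection.injective (↔⇒↣ (↔-sym enum))) (Uniqueₚ.allFin⁺ order)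

  #_ : {Q : Carrier → Set} → Decidable Q → ℕ
  # Q? = length (filter Q? elements)

  length≡# : {Q : Carrier → Set} (Q? : Decidable Q) {xs : List Carrier} → Unique xs →
    (∀ {x} → x ∈ xs → Q x) → (∀ {x} → Q x → x ∈ xs) → length xs ≡ # Q?
  length≡# Q? uxs sound complete = unique∧set⇒length≡ uxs (Uniqueₚ.filter⁺ Q? elements-unique)
    (λ {x} x∈xs → ∈ₚ.∈-filter⁺ Q? (∈-elements x) (sound x∈xs))
    (λ x∈Q → complete (proj₂ (∈ₚ.∈-filter⁻ Q? {xs = elements} x∈Q)))

  annihilator-≤-order : ∀ x → ∃[ n ] (1 ≤ n × n ≤ order × n · x ≡ 0#)
  annihilator-≤-order x
    with Finₚ.pigeonhole (ℕₚ.n<1+n order) (λ (i : Fin (suc order)) → Inverse.to enum (toℕ i · x))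
  ... | i , j , i<j , ix≡jx = toℕ j ∸ toℕ i , ℕₚ.m<n⇒0<n∸m i<j ,
    ℕₚ.≤-trans (ℕₚ.m∸n≤m (toℕ j) (toℕ i)) (ℕₚ.m<1+n⇒m≤n (Finₚ.toℕ<n j)) ,
    ∙-cancelʳ (toℕ i · x) _ _ (begin
      (toℕ j ∸ toℕ i) · x + toℕ i · x  ≡⟨ sym (×-homo-+ x (toℕ j ∸ toℕ i) (toℕ i)) ⟩
      (toℕ j ∸ toℕ i ℕ.+ toℕ i) · x    ≡⟨ cong (_· x) (ℕₚ.m∸n+n≡m (ℕₚ.<⇒≤ i<j)) ⟩
      toℕ j · x                        ≡⟨ sym (Injection.injective (↔⇒↣ enum) ix≡jx) ⟩
      toℕ i · x                        ≡⟨ sym (identityˡ _) ⟩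
      0# + toℕ i · x                   ∎)
    where open ≡-Reasoning

  -- order ! is a common multiple of all element orders; we never need the true exponent.
  E : ℕ
  E = order !

  instance
    E-nonZero : NonZero E
    E-nonZero = ℕ.>-nonZero (ℕₚ.1≤n! order)

  E·≡0 : ∀ x → E · x ≡ 0#
  E·≡0 x with annihilator-≤-order x
  ... | suc n , _ , n≤order , nx≡0 = ·≡0-∣ (ℕ∣.∣-trans (ℕ∣.m∣m*n {suc n} (n !)) (ℕ∣.m≤n⇒m!∣n! n≤order)) nx≡0

  -≡[E∸1]· : ∀ x → - x ≡ (E ∸ 1) · x
  -≡[E∸1]· x = sym (inverseʳ-unique x _ (begin
    suc (E ∸ 1) · x          ≡⟨ cong (_· x) (ℕₚ.m+[n∸m]≡n (ℕₚ.1≤n! order)) ⟩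
    E · x                    ≡⟨ E·≡0 x ⟩
    0#                       ∎))
    where open ≡-Reasoning

  -- The decomposition G = P ⊕ H into the 2-part and the odd part

  odd·≡0∧2·≡0⇒≡0 : ∀ {n y} → Odd n → n · y ≡ 0# → 2 · y ≡ 0# → y ≡ 0#
  odd·≡0∧2·≡0⇒≡0 {y = y} (k , refl) ny≡0 2y≡0 = begin
    y                    ≡⟨ sym (identityʳ y) ⟩
    y + 0#               ≡⟨ cong (y +_) (sym (·≡0-∣ (ℕ∣.n∣m*n k) 2y≡0)) ⟩
    y + (k ℕ.* 2) · y    ≡⟨ cong (λ t → y + t · y) (ℕₚ.*-comm k 2) ⟩
    suc (2 ℕ.* k) · y    ≡⟨ ny≡0 ⟩
    0#                   ∎
    where open ≡-Reasoning

  odd·≡0∧2^·≡0⇒≡0 : ∀ {n y} b → Odd n → n · y ≡ 0# → (2 ^ b) · y ≡ 0# → y ≡ 0#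
  odd·≡0∧2^·≡0⇒≡0 zero _ _ 1y≡0 = trans (sym (×-homo-1 _)) 1y≡0
  odd·≡0∧2^·≡0⇒≡0 {n} {y} (suc b) n-odd ny≡0 2^[1+b]y≡0 =
    odd·≡0∧2·≡0⇒≡0 n-odd ny≡0 (odd·≡0∧2^·≡0⇒≡0 b n-odd n[2y]≡0 2^b[2y]≡0)
    where
    n[2y]≡0 : n · (2 · y) ≡ 0#
    n[2y]≡0 = trans (·-comm n 2 y) (trans (cong (2 ·_) ny≡0) (·-zeroʳ 2))
    2^b[2y]≡0 : (2 ^ b) · (2 · y) ≡ 0#
    2^b[2y]≡0 = trans (sym (·-assoc (2 ^ b) 2 y)) (trans (cong (_· y) (ℕₚ.*-comm (2 ^ b) 2)) 2^[1+b]y≡0)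

  opaque
    a : ℕ
    a = proj₁ (2-adic E (ℕₚ.1≤n! order))

    D : ℕ
    D = proj₁ (proj₂ (2-adic E (ℕₚ.1≤n! order)))

    D-odd : Odd D
    D-odd = proj₁ (proj₂ (proj₂ (2-adic E (ℕₚ.1≤n! order))))

    E≡2^a*D : E ≡ 2 ^ a ℕ.* D
    E≡2^a*D = proj₂ (proj₂ (proj₂ (2-adic E (ℕₚ.1≤n! order))))

  InP : Carrier → Set
  InP x = (2 ^ a) · x ≡ 0#

  InH : Carrier → Set
  InH x = D · x ≡ 0#

  InP-- : ∀ {x y} → InP x → InP y → InP (x - y)
  InP-- {x} {y} x∈P y∈P = trans (·-- (2 ^ a) x y) (x≈y⇒x∙y⁻¹≈ε (trans x∈P (sym y∈P)))

  InP∧InH⇒≡0 : ∀ {x} → InP x → InH x → x ≡ 0#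
  InP∧InH⇒≡0 x∈P x∈H = odd·≡0∧2^·≡0⇒≡0 a D-odd x∈H x∈P

  InP-D· : ∀ y → InP (D · y)
  InP-D· y = trans (sym (·-assoc (2 ^ a) D y)) (trans (cong (_· y) (sym E≡2^a*D)) (E·≡0 y))

  -- Multiplication by (1 + D)^a, which is ≡ 1 modulo D and divisible by 2^a, projects onto H.
  private
    q : ℕ
    q = proj₁ (suc^≡1+* D a)

  πH : Carrier → Carrier
  πH x = (suc D ^ a) · x

  πH-InH : ∀ x → InH (πH x)
  πH-InH x = trans (sym (·-assoc D (suc D ^ a) x)) (·≡0-∣ E∣D*[1+D]^a (E·≡0 x))
    where
    2∣1+D : 2 ∣ suc D
    2∣1+D = divides (suc (proj₁ D-odd)) (trans (cong suc (proj₂ D-odd)) (cong (2 ℕ.+_) (ℕₚ.*-comm 2 (proj₁ D-odd))))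
    E∣D*[1+D]^a : E ∣ D ℕ.* suc D ^ a
    E∣D*[1+D]^a = subst (_∣ D ℕ.* suc D ^ a) (sym E≡2^a*D)
      (subst (2 ^ a ℕ.* D ∣_) (ℕₚ.*-comm (suc D ^ a) D) (ℕ∣.*-monoˡ-∣ D (^-monoˡ-∣ a 2∣1+D)))

  πP : Carrier → Carrier
  πP x = x - πH x

  πP∈D·G : ∀ x → ∃[ y ] πP x ≡ D · y
  πP∈D·G x = - (q · x) , (begin
    x - (suc D ^ a) · x                 ≡⟨ cong (λ n → x - n · x) (proj₂ (suc^≡1+* D a)) ⟩
    x - (x + (D ℕ.* q) · x)             ≡⟨ cong (x +_) (sym (⁻¹-∙-comm x _)) ⟩
    x + (- x + - ((D ℕ.* q) · x))       ≡⟨ sym (assoc x (- x) _) ⟩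
    (x - x) + - ((D ℕ.* q) · x)         ≡⟨ cong (_+ - ((D ℕ.* q) · x)) (inverseʳ x) ⟩
    0# + - ((D ℕ.* q) · x)              ≡⟨ identityˡ _ ⟩
    - ((D ℕ.* q) · x)                   ≡⟨ cong -_ (·-assoc D q x) ⟩
    - (D · (q · x))                     ≡⟨ sym (·-neg D (q · x)) ⟩
    D · (- (q · x))                     ∎)
    where open ≡-Reasoning

  πP+πH≡id : ∀ x → πP x + πH x ≡ x
  πP+πH≡id x = x-y+y≡x x (πH x)

  -- Bases of the subgroups 2^j D G

  opaque
    N : ℕ → ℕ
    N j = 2 ^ j ℕ.* D

    N-suc : ∀ j y → N (suc j) · y ≡ 2 · (N j · y)
    N-suc j y = trans (cong (_· y) (ℕₚ.*-assoc 2 (2 ^ j) D)) (·-assoc 2 (N j) y)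

    N-zero : N 0 ≡ D
    N-zero = ℕₚ.*-identityˡ D

    N-top : N a ≡ E
    N-top = sym E≡2^a*D

  -- A basis at level j is a list of pairs (β , y) standing for the generators N j · y of order 2^β;
  -- storing y rather than N j · y is what lets a basis at level j + 1 be halved to level j.
  Basis : Set
  Basis = List (ℕ × Carrier)

  -- Coefficients missing at the end of the list count as 0.
  lincomb : ℕ → Basis → List ℕ → Carrier
  lincomb j []             ks       = 0#
  lincomb j (_ ∷ B)        []       = 0#
  lincomb j ((_ , y) ∷ B) (k ∷ ks) = k · (N j · y) + lincomb j B ks

  OrdersDivide : Basis → List ℕ → Set
  OrdersDivide []             _        = ⊤
  OrdersDivide (_ ∷ _)        []       = ⊤
  OrdersDivide ((β , _) ∷ B) (k ∷ ks) = 2 ^ β ∣ k × OrdersDivide B ks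

  HasOrders : ℕ → Basis → Set
  HasOrders j = All (λ (β , y) → 1 ≤ β × (2 ^ β) · (N j · y) ≡ 0#)

  Independent : ℕ → Basis → Set
  Independent j B = ∀ ks → lincomb j B ks ≡ 0# → OrdersDivide B ks

  InSpan : ℕ → Basis → Carrier → Set
  InSpan j B z = ∃[ ks ] lincomb j B ks ≡ z

  record IsBasis (j : ℕ) (B : Basis) : Set where
    field
      orders      : HasOrders j B
      independent : Independent j B
      spans       : ∀ x → InSpan j B (N j · x)

  lincomb-[] : ∀ j B → lincomb j B [] ≡ 0#
  lincomb-[] j []      = refl
  lincomb-[] j (_ ∷ B) = refl

  _⊕_ : List ℕ → List ℕ → List ℕ
  []       ⊕ ls       = ls
  (k ∷ ks) ⊕ []       = k ∷ ks
  (k ∷ ks) ⊕ (l ∷ ls) = k ℕ.+ l ∷ ks ⊕ ls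

  lincomb-⊕ : ∀ j B ks ls → lincomb j B (ks ⊕ ls) ≡ lincomb j B ks + lincomb j B ls
  lincomb-⊕ j []             ks       ls       = sym (identityˡ 0#)
  lincomb-⊕ j (_ ∷ B)        []       ls       = sym (identityˡ _)
  lincomb-⊕ j (_ ∷ B)        (k ∷ ks) []       = sym (identityʳ _)
  lincomb-⊕ j ((_ , y) ∷ B) (k ∷ ks) (l ∷ ls) =
    trans (cong₂ _+_ (×-homo-+ (N j · y) k l) (lincomb-⊕ j B ks ls)) (interchange _ _ _ _)

  ·-lincomb : ∀ j B ks n → n · lincomb j B ks ≡ lincomb j B (map (n ℕ.*_) ks)
  ·-lincomb j []             ks       n = ·-zeroʳ n
  ·-lincomb j (_ ∷ B)        []       n = ·-zeroʳ n
  ·-lincomb j ((_ , y) ∷ B) (k ∷ ks) n =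
    trans (×-distrib-+ _ _ n) (cong₂ _+_ (sym (·-assoc n k _)) (·-lincomb j B ks n))

  -lincomb : ∀ j B ks → - lincomb j B ks ≡ lincomb j B (map ((E ∸ 1) ℕ.*_) ks)
  -lincomb j B ks = trans (-≡[E∸1]· _) (·-lincomb j B ks (E ∸ 1))

  lincombʸ : Basis → List ℕ → Carrier
  lincombʸ []             ks       = 0#
  lincombʸ (_ ∷ B)        []       = 0#
  lincombʸ ((_ , y) ∷ B) (k ∷ ks) = k · y + lincombʸ B ks

  lincomb≡N· : ∀ j B ks → lincomb j B ks ≡ N j · lincombʸ B ks
  lincomb≡N· j []             ks       = sym (·-zeroʳ (N j))
  lincomb≡N· j (_ ∷ B)        []       = sym (·-zeroʳ (N j))
  lincomb≡N· j ((_ , y) ∷ B) (k ∷ ks) =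
    trans (cong₂ _+_ (·-comm k (N j) y) (lincomb≡N· j B ks)) (sym (×-distrib-+ _ _ (N j)))

  2·lincomb : ∀ j B ks → 2 · lincomb j B ks ≡ lincomb (suc j) B ks
  2·lincomb j B ks = begin
    2 · lincomb j B ks              ≡⟨ cong (2 ·_) (lincomb≡N· j B ks) ⟩
    2 · (N j · lincombʸ B ks)       ≡⟨ sym (N-suc j _) ⟩
    N (suc j) · lincombʸ B ks       ≡⟨ sym (lincomb≡N· (suc j) B ks) ⟩
    lincomb (suc j) B ks            ∎
    where open ≡-Reasoning

  -- The span as an explicit list: coefficients below E suffice.
  spanList : ℕ → Basis → List Carrier
  spanList j []             = 0# ∷ []
  spanList j ((_ , y) ∷ B) = concatMap (λ k → map (k · (N j · y) +_) (spanList j B)) (upTo E)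

  spanList-sound : ∀ j B {z} → z ∈ spanList j B → InSpan j B z
  spanList-sound j [] (here refl) = [] , refl
  spanList-sound j ((_ , y) ∷ B) z∈
    with find (∈ₚ.∈-concatMap⁻ (λ k → map (k · (N j · y) +_) (spanList j B)) {xs = upTo E} z∈)
  ... | k , _ , z∈k
    with ∈ₚ.∈-map⁻ (k · (N j · y) +_) z∈k
  ... | s , s∈ , refl
    with spanList-sound j B s∈
  ... | ks , refl = k ∷ ks , refl

  ∈-spanList-∷ : ∀ j β y B k {s} → s ∈ spanList j B → k · (N j · y) + s ∈ spanList j ((β , y) ∷ B)
  ∈-spanList-∷ j β y B k {s} s∈ =
    ∈ₚ.∈-concatMap⁺ (λ k → map (k · (N j · y) +_) (spanList j B))
      (lose (∈ₚ.∈-upTo⁺ (m%n<n k E))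
        (subst (_∈ map ((k % E) · (N j · y) +_) (spanList j B))
          (cong (_+ s) (sym (·-mod k (E·≡0 _))))
          (∈ₚ.∈-map⁺ ((k % E) · (N j · y) +_) s∈)))

  spanList-complete : ∀ j B ks → lincomb j B ks ∈ spanList j B
  spanList-complete j [] ks = here refl
  spanList-complete j ((β , y) ∷ B) [] =
    subst (_∈ spanList j ((β , y) ∷ B)) (trans (identityˡ _) (lincomb-[] j B))
      (∈-spanList-∷ j β y B 0 (spanList-complete j B []))
  spanList-complete j ((β , y) ∷ B) (k ∷ ks) = ∈-spanList-∷ j β y B k (spanList-complete j B ks)

  independent-∷ : ∀ {j B y} → Independent j B → ¬ (N j · y ∈ spanList j B) → 2 · (N j · y) ≡ 0# →
    Independent j ((1 , y) ∷ B)
  independent-∷ ind ∉span 2v≡0 [] _ = tt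
  independent-∷ {j} {B} {y} ind ∉span 2v≡0 (k ∷ ks) comb≡0 with parity k
  ... | i , inj₁ refl = ℕ∣.m∣m*n i , ind ks (begin
    lincomb j B ks                            ≡⟨ sym (identityˡ _) ⟩
    0# + lincomb j B ks                       ≡⟨ cong (_+ lincomb j B ks) (sym (·≡0-∣ (ℕ∣.m∣m*n {2} i) 2v≡0)) ⟩
    (2 ℕ.* i) · (N j · y) + lincomb j B ks    ≡⟨ comb≡0 ⟩
    0#                                        ∎)
    where open ≡-Reasoning
  ... | i , inj₂ refl = ⊥-elim (∉span (subst (_∈ spanList j B) (sym v≡comb) (spanList-complete j B _)))
    where
    open ≡-Reasoning
    v+comb≡0 : N j · y + lincomb j B ks ≡ 0#
    v+comb≡0 = begin
      N j · y + lincomb j B ks                           ≡⟨ cong (λ t → t + lincomb j B ks) (sym (identityʳ _)) ⟩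
      N j · y + 0# + lincomb j B ks                      ≡⟨ cong (λ t → N j · y + t + lincomb j B ks)
                                                             (sym (·≡0-∣ (ℕ∣.m∣m*n {2} i) 2v≡0)) ⟩
      N j · y + (2 ℕ.* i) · (N j · y) + lincomb j B ks   ≡⟨ comb≡0 ⟩
      0#                                                 ∎
    v≡comb : N j · y ≡ lincomb j B (map ((E ∸ 1) ℕ.*_) ks)
    v≡comb = trans (inverseʳ-unique _ _ (trans (comm _ _) v+comb≡0)) (-lincomb j B ks)

  extend : ℕ → List Carrier → Basis → Basis
  extend j []       B = B
  extend j (y ∷ ys) B with N j · y ∈? spanList j B
  ... | yes _ = extend j ys B
  ... | no  _ = extend j ys ((1 , y) ∷ B)

  Candidate : ℕ → Carrier → Set
  Candidate j y = N (suc j) · y ≡ 0#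

  extend-orders : ∀ j ys B → All (Candidate j) ys → HasOrders j B → HasOrders j (extend j ys B)
  extend-orders j []       B _ os = os
  extend-orders j (y ∷ ys) B (c ∷ cs) os with N j · y ∈? spanList j B
  ... | yes _ = extend-orders j ys B cs os
  ... | no  _ = extend-orders j ys ((1 , y) ∷ B) cs ((s≤s z≤n , trans (sym (N-suc j y)) c) ∷ os)

  extend-independent : ∀ j ys B → All (Candidate j) ys → Independent j B → Independent j (extend j ys B)
  extend-independent j []       B _ ind = ind
  extend-independent j (y ∷ ys) B (c ∷ cs) ind with N j · y ∈? spanList j B
  ... | yes _    = extend-independent j ys B cs ind
  ... | no  ∉span =
    extend-independent j ys ((1 , y) ∷ B) cs (independent-∷ ind ∉span (trans (sym (N-suc j y)) c))

  extend-⊇ : ∀ j ys B {z} → InSpan j B z → InSpan j (extend j ys B) z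
  extend-⊇ j []       B z∈ = z∈
  extend-⊇ j (y ∷ ys) B (ks , eq) with N j · y ∈? spanList j B
  ... | yes _ = extend-⊇ j ys B (ks , eq)
  ... | no  _ = extend-⊇ j ys ((1 , y) ∷ B) (0 ∷ ks , trans (identityˡ _) eq)

  extend-covers : ∀ j ys B {y} → y ∈ ys → InSpan j (extend j ys B) (N j · y)
  extend-covers j (y ∷ ys) B (here refl) with N j · y ∈? spanList j B
  ... | yes v∈ = extend-⊇ j ys B (spanList-sound j B v∈)
  ... | no  _  = extend-⊇ j ys ((1 , y) ∷ B)
    (1 ∷ [] , trans (cong (1 · (N j · y) +_) (lincomb-[] j B)) (trans (identityʳ _) (×-homo-1 _)))
  extend-covers j (y′ ∷ ys) B (there y∈) with N j · y′ ∈? spanList j B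
  ... | yes _ = extend-covers j ys B y∈
  ... | no  _ = extend-covers j ys ((1 , y′) ∷ B) y∈

  InSpan-+ : ∀ {j B u v} → InSpan j B u → InSpan j B v → InSpan j B (u + v)
  InSpan-+ {j} {B} (ks , refl) (ls , refl) = ks ⊕ ls , lincomb-⊕ j B ks ls

  -- Halving: a basis at level j + 1 becomes one at level j with every order doubled.

  lift : Basis → Basis
  lift = map (λ (β , y) → suc β , y)

  lincomb-lift : ∀ j B ks → lincomb j (lift B) ks ≡ lincomb j B ks
  lincomb-lift j []             ks       = refl
  lincomb-lift j (_ ∷ B)        []       = refl
  lincomb-lift j ((_ , y) ∷ B) (k ∷ ks) = cong (k · (N j · y) +_) (lincomb-lift j B ks)

  HasOrders-lift : ∀ j B → HasOrders (suc j) B → HasOrders j (lift B)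
  HasOrders-lift j []             []                  = []
  HasOrders-lift j ((β , y) ∷ B) ((_ , 2^βv≡0) ∷ os) = (s≤s z≤n , 2^[1+β]v≡0) ∷ HasOrders-lift j B os
    where
    open ≡-Reasoning
    2^[1+β]v≡0 : (2 ^ suc β) · (N j · y) ≡ 0#
    2^[1+β]v≡0 = begin
      (2 ℕ.* 2 ^ β) · (N j · y)   ≡⟨ cong (_· (N j · y)) (ℕₚ.*-comm 2 (2 ^ β)) ⟩
      (2 ^ β ℕ.* 2) · (N j · y)   ≡⟨ ·-assoc (2 ^ β) 2 _ ⟩
      (2 ^ β) · (2 · (N j · y))   ≡⟨ cong ((2 ^ β) ·_) (sym (N-suc j y)) ⟩
      (2 ^ β) · (N (suc j) · y)   ≡⟨ 2^βv≡0 ⟩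
      0#                          ∎

  halve : List ℕ → List ℕ
  halve = map (_/ 2)

  lincomb-halve : ∀ j B ks → HasOrders (suc j) B → OrdersDivide B ks →
    lincomb (suc j) B (halve ks) ≡ lincomb j B ks
  lincomb-halve j []             ks       _               _              = refl
  lincomb-halve j (_ ∷ B)        []       _               _              = refl
  lincomb-halve j ((β , y) ∷ B) (k ∷ ks) ((1≤β , _) ∷ os) (2^β∣k , divs) =
    cong₂ _+_ halved (lincomb-halve j B ks os divs)
    where
    open ≡-Reasoning
    halved : (k / 2) · (N (suc j) · y) ≡ k · (N j · y)
    halved = begin
      (k / 2) · (N (suc j) · y)     ≡⟨ cong ((k / 2) ·_) (N-suc j y) ⟩
      (k / 2) · (2 · (N j · y))     ≡⟨ sym (·-assoc (k / 2) 2 _) ⟩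
      (k / 2 ℕ.* 2) · (N j · y)     ≡⟨ cong (_· (N j · y)) (m/n*n≡m (2^∣⇒2∣ 1≤β 2^β∣k)) ⟩
      k · (N j · y)                 ∎

  OrdersDivide-halve : ∀ {j} B ks → HasOrders j B → OrdersDivide B ks → OrdersDivide B (halve ks) →
    OrdersDivide (lift B) ks
  OrdersDivide-halve []             ks       _                 _              _                = tt
  OrdersDivide-halve (_ ∷ B)        []       _                 _              _                = tt
  OrdersDivide-halve ((β , y) ∷ B) (k ∷ ks) ((1≤β , _) ∷ os) (2^β∣k , divs) (2^β∣k/2 , divs/2) =
    ℕ∣.m∣n/o⇒o*m∣n (2^∣⇒2∣ 1≤β 2^β∣k) 2^β∣k/2 , OrdersDivide-halve B ks os divs divs/2

  Independent-lift : ∀ j B → HasOrders (suc j) B → Independent (suc j) B → Independent j (lift B)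
  Independent-lift j B os ind ks comb≡0 =
    OrdersDivide-halve B ks os divs (ind (halve ks) (trans (lincomb-halve j B ks os divs) comb₀≡0))
    where
    comb₀≡0 : lincomb j B ks ≡ 0#
    comb₀≡0 = trans (sym (lincomb-lift j B ks)) comb≡0
    divs : OrdersDivide B ks
    divs = ind ks (trans (sym (2·lincomb j B ks)) (trans (cong (2 ·_) comb₀≡0) (·-zeroʳ 2)))

  basis-step : ∀ {j B} → IsBasis (suc j) B → Σ Basis (IsBasis j)
  basis-step {j} {B} isBasis = extended , record
    { orders      = extend-orders j candidates (lift B) candidates-ok (HasOrders-lift j B orders)
    ; independent = extend-independent j candidates (lift B) candidates-ok (Independent-lift j B orders independent)
    ; spans       = spans′
    }
    where
    open IsBasis isBasis
    candidates : List Carrier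
    candidates = filter (λ y → (N (suc j) · y) ≟ 0#) elements
    candidates-ok : All (Candidate j) candidates
    candidates-ok = Allₚ.all-filter (λ y → (N (suc j) · y) ≟ 0#) elements
    extended : Basis
    extended = extend j candidates (lift B)
    -- If N (j + 1) x is spanned by the combination w of the y's, then x - w is a candidate.
    spans′ : ∀ x → InSpan j extended (N j · x)
    spans′ x with spans x
    ... | ks , comb≡Nx = subst (InSpan j extended) N·x≡
          (InSpan-+ {B = extended} x-w-covered (extend-⊇ j candidates (lift B) (ks , refl)))
      where
      open ≡-Reasoning
      w : Carrier
      w = lincombʸ B ks
      x-w-covered : InSpan j extended (N j · (x - w))
      x-w-covered = extend-covers j candidates (lift B) (∈ₚ.∈-filter⁺ _ (∈-elements (x - w))
        (·≡·⇒·-≡0 {N (suc j)} (trans (sym comb≡Nx) (lincomb≡N· (suc j) B ks))))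
      N·x≡ : N j · (x - w) + lincomb j (lift B) ks ≡ N j · x
      N·x≡ = begin
        N j · (x - w) + lincomb j (lift B) ks
          ≡⟨ cong (N j · (x - w) +_) (trans (lincomb-lift j B ks) (lincomb≡N· j B ks)) ⟩
        N j · (x - w) + N j · w   ≡⟨ sym (×-distrib-+ _ _ (N j)) ⟩
        N j · ((x - w) + w)       ≡⟨ cong (N j ·_) (x-y+y≡x x w) ⟩
        N j · x                   ∎

  -- Downward from level a, where the empty basis spans N a · G = 0.
  basis-above : ∀ t j → t ℕ.+ j ≡ a → Σ Basis (IsBasis j)
  basis-above zero j refl = [] , record
    { orders = [] ; independent = λ _ _ → tt
    ; spans = λ x → [] , sym (trans (cong (_· x) N-top) (E·≡0 x)) }
  basis-above (suc t) j t+1+j≡a = basis-step (proj₂ (basis-above t (suc j) (trans (ℕₚ.+-suc t j) t+1+j≡a)))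

  opaque
    basis₀ : Σ Basis (IsBasis 0)
    basis₀ = basis-above a 0 (ℕₚ.+-identityʳ a)

  -- The structure theorem G ≅ Z_{2^α₁} × ⋯ × Z_{2^αₘ} × H

  InH? : Decidable InH
  InH? x = (D · x) ≟ 0#

  d : ℕ
  d = # InH?

  InH-0 : InH 0#
  InH-0 = ·-zeroʳ D

  InH-+ : ∀ {x y} → InH x → InH y → InH (x + y)
  InH-+ {x} {y} x∈H y∈H = trans (×-distrib-+ x y D) (trans (cong₂ _+_ x∈H y∈H) (identityˡ 0#))

  InH-- : ∀ {x} → InH x → InH (- x)
  InH-- {x} x∈H = trans (·-neg D x) (trans (cong -_ x∈H) ε⁻¹≈ε)

  InH-· : ∀ {x} k → InH x → InH (k · x)
  InH-· {x} k x∈H = trans (·-comm D k x) (trans (cong (k ·_) x∈H) (·-zeroʳ k))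

  H : Set
  H = Σ Carrier InH

  ≡-H : ∀ {x y} {p : InH x} {q : InH y} → x ≡ y → (x , p) ≡ (y , q)
  ≡-H = Σ-≡-irrelevant uip

  _+H_ : H → H → H
  (x , x∈H) +H (y , y∈H) = x + y , InH-+ x∈H y∈H

  -H_ : H → H
  -H (x , x∈H) = - x , InH-- x∈H

  oddPart : FinAbGroup
  oddPart = record
    { Carrier = H ; _+_ = _+H_ ; 0# = 0# , InH-0 ; -_ = -H_
    ; isAbelianGroup = record
      { isGroup = record
        { isMonoid = record
          { isSemigroup = record
            { isMagma = record { isEquivalence = isEquivalence ; ∙-cong = cong₂ _+H_ }
            ; assoc = λ (x , _) (y , _) (z , _) → ≡-H (assoc x y z) }
          ; identity = (λ (x , _) → ≡-H (identityˡ x)) , (λ (x , _) → ≡-H (identityʳ x)) }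
        ; inverse = (λ (x , _) → ≡-H (inverseˡ x)) , (λ (x , _) → ≡-H (inverseʳ x))
        ; ⁻¹-cong = cong -H_ }
      ; comm = λ (x , _) (y , _) → ≡-H (comm x y) }
    ; order = d
    ; enum = Σ↔Fin-length (filter InH? elements) (Uniqueₚ.filter⁺ InH? elements-unique)
               (λ x∈ → proj₂ (∈ₚ.∈-filter⁻ InH? {xs = elements} x∈))
               (λ {x} x∈H → ∈ₚ.∈-filter⁺ InH? (∈-elements x) x∈H) uip
    }

  toℕ-mod2^-· : ∀ β {v} m → (2 ^ β) · v ≡ 0# → toℕ (m mod2^ β) · v ≡ m · v
  toℕ-mod2^-· β {v} m 2^βv≡0 =
    trans (cong (_· v) (Finₚ.toℕ-fromℕ< (m%n<n m (2 ^ β)))) (sym (·-mod m 2^βv≡0))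
    where instance _ = ℕₚ.m^n≢0 2 β

  embed : (B : Basis) → Cyc2Prod (map proj₁ B) → Carrier
  embed []             _        = 0#
  embed ((_ , y) ∷ B) (c , cs) = toℕ c · (N 0 · y) + embed B cs

  embed-+ : ∀ B → HasOrders 0 B → ∀ c c′ → embed B (addCyc2 (map proj₁ B) c c′) ≡ embed B c + embed B c′
  embed-+ []             _                  _        _          = sym (identityˡ 0#)
  embed-+ ((β , y) ∷ B) ((_ , 2^βv≡0) ∷ os) (c , cs) (c′ , cs′) = trans
    (cong₂ _+_ (trans (toℕ-mod2^-· β (toℕ c ℕ.+ toℕ c′) 2^βv≡0) (×-homo-+ _ (toℕ c) (toℕ c′))) (embed-+ B os cs cs′))
    (interchange _ _ _ _)

  residues : (B : Basis) → List ℕ → Cyc2Prod (map proj₁ B)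
  residues []             _        = tt
  residues ((β , _) ∷ B) []       = zeros (β ∷ map proj₁ B)
  residues ((β , _) ∷ B) (k ∷ ks) = k mod2^ β , residues B ks

  embed-zeros : ∀ B → HasOrders 0 B → embed B (zeros (map proj₁ B)) ≡ 0#
  embed-zeros []             _                  = refl
  embed-zeros ((β , y) ∷ B) ((_ , 2^βv≡0) ∷ os) =
    trans (cong₂ _+_ (toℕ-mod2^-· β 0 2^βv≡0) (embed-zeros B os)) (identityˡ 0#)

  embed-residues : ∀ B → HasOrders 0 B → ∀ ks → embed B (residues B ks) ≡ lincomb 0 B ks
  embed-residues []             _                  ks       = refl
  embed-residues ((β , y) ∷ B) os                   []       = embed-zeros ((β , y) ∷ B) os
  embed-residues ((β , y) ∷ B) ((_ , 2^βv≡0) ∷ os) (k ∷ ks) =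
    cong₂ _+_ (toℕ-mod2^-· β k 2^βv≡0) (embed-residues B os ks)

  differences : (B : Basis) → Cyc2Prod (map proj₁ B) → Cyc2Prod (map proj₁ B) → List ℕ
  differences []             _        _          = []
  differences ((β , _) ∷ B) (c , cs) (c′ , cs′) = toℕ c ℕ.+ (2 ^ β ∸ toℕ c′) ∷ differences B cs cs′

  lincomb-differences : ∀ B → HasOrders 0 B → ∀ c c′ → lincomb 0 B (differences B c c′) ≡ embed B c - embed B c′
  lincomb-differences []             _                  _        _          = sym (inverseʳ 0#)
  lincomb-differences ((β , y) ∷ B) ((_ , 2^βv≡0) ∷ os) (c , cs) (c′ , cs′) = begin
    (toℕ c ℕ.+ (2 ^ β ∸ toℕ c′)) · v + lincomb 0 B (differences B cs cs′)
      ≡⟨ cong₂ _+_ (+∸·≡- (toℕ c) (toℕ c′) 2^βv≡0 (ℕₚ.<⇒≤ (Finₚ.toℕ<n c′))) (lincomb-differences B os cs cs′) ⟩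
    (toℕ c · v - toℕ c′ · v) + (embed B cs - embed B cs′)
      ≡⟨ interchange _ _ _ _ ⟩
    (toℕ c · v + embed B cs) + (- (toℕ c′ · v) + - embed B cs′)
      ≡⟨ cong ((toℕ c · v + embed B cs) +_) (⁻¹-∙-comm _ _) ⟩
    (toℕ c · v + embed B cs) - (toℕ c′ · v + embed B cs′) ∎
    where
    open ≡-Reasoning
    v = N 0 · y

  OrdersDivide-differences⇒≡ : ∀ B c c′ → OrdersDivide B (differences B c c′) → c ≡ c′
  OrdersDivide-differences⇒≡ []             _        _          _            = refl
  OrdersDivide-differences⇒≡ ((β , _) ∷ B) (c , cs) (c′ , cs′) (2^β∣ , divs) = cong₂ _,_
    (Fin-∣+∸⇒≡ c c′ 2^β∣)
    (OrdersDivide-differences⇒≡ B cs cs′ divs)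

  embed-injective : ∀ B → HasOrders 0 B → Independent 0 B → ∀ {c c′} → embed B c ≡ embed B c′ → c ≡ c′
  embed-injective B os ind {c} {c′} eq = OrdersDivide-differences⇒≡ B c c′
    (ind _ (trans (lincomb-differences B os c c′) (x≈y⇒x∙y⁻¹≈ε eq)))

  InP-embed : ∀ B c → InP (embed B c)
  InP-embed []             _        = ·-zeroʳ (2 ^ a)
  InP-embed ((_ , y) ∷ B) (c , cs) = begin
    (2 ^ a) · (toℕ c · (N 0 · y) + embed B cs)               ≡⟨ ×-distrib-+ _ _ (2 ^ a) ⟩
    (2 ^ a) · (toℕ c · (N 0 · y)) + (2 ^ a) · embed B cs     ≡⟨ cong₂ _+_ (·-comm (2 ^ a) (toℕ c) _) (InP-embed B cs) ⟩
    toℕ c · ((2 ^ a) · (N 0 · y)) + 0#                       ≡⟨ cong (λ t → toℕ c · ((2 ^ a) · (t · y)) + 0#) N-zero ⟩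
    toℕ c · ((2 ^ a) · (D · y)) + 0#                         ≡⟨ cong (λ t → toℕ c · t + 0#) (InP-D· y) ⟩
    toℕ c · 0# + 0#                                          ≡⟨ trans (identityʳ _) (·-zeroʳ (toℕ c)) ⟩
    0#                                                       ∎
    where open ≡-Reasoning

  B₀ : Basis
  B₀ = proj₁ basis₀

  module B₀ = IsBasis (proj₂ basis₀)

  αs : List ℕ
  αs = map proj₁ B₀

  Φ : Cyc2Prod αs × H → Carrier
  Φ (c , (h , _)) = embed B₀ c + h

  Φ-injective : ∀ {u v} → Φ u ≡ Φ v → u ≡ v
  Φ-injective {c , (h , h∈H)} {c′ , (h′ , h′∈H)} Φu≡Φv =
    cong₂ _,_ (embed-injective B₀ B₀.orders B₀.independent (x∙y⁻¹≈ε⇒x≈y _ _ embed-diff≡0))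
              (≡-H (sym (x∙y⁻¹≈ε⇒x≈y _ _ (trans (sym diffs) embed-diff≡0))))
    where
    diffs : embed B₀ c - embed B₀ c′ ≡ h′ - h
    diffs = +≡+⇒-≡- Φu≡Φv
    embed-diff≡0 : embed B₀ c - embed B₀ c′ ≡ 0#
    embed-diff≡0 = InP∧InH⇒≡0 (InP-- (InP-embed B₀ c) (InP-embed B₀ c′))
                               (subst InH (sym diffs) (InH-+ h′∈H (InH-- h∈H)))

  toProduct : Carrier → Cyc2Prod αs × H
  toProduct x = residues B₀ (proj₁ (B₀.spans (proj₁ (πP∈D·G x)))) , (πH x , πH-InH x)

  Φ-toProduct : ∀ x → Φ (toProduct x) ≡ x
  Φ-toProduct x = begin
    embed B₀ (residues B₀ ks) + πH x   ≡⟨ cong (_+ πH x) (embed-residues B₀ B₀.orders ks) ⟩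
    lincomb 0 B₀ ks + πH x             ≡⟨ cong (_+ πH x) (proj₂ (B₀.spans y)) ⟩
    N 0 · y + πH x                     ≡⟨ cong (λ n → n · y + πH x) N-zero ⟩
    D · y + πH x                       ≡⟨ cong (_+ πH x) (sym (proj₂ (πP∈D·G x))) ⟩
    πP x + πH x                        ≡⟨ πP+πH≡id x ⟩
    x                                  ∎
    where
    open ≡-Reasoning
    y = proj₁ (πP∈D·G x)
    ks = proj₁ (B₀.spans y)

  φ : Carrier ↔ (Cyc2Prod αs × H)
  φ = mk↔ₛ′ toProduct Φ (λ u → Φ-injective (Φ-toProduct (Φ u))) Φ-toProduct

  φ-hom : ∀ x y → toProduct (x + y)
    ≡ (addCyc2 αs (proj₁ (toProduct x)) (proj₁ (toProduct y)) , proj₂ (toProduct x) +H proj₂ (toProduct y))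
  φ-hom x y = Φ-injective (begin
    Φ (toProduct (x + y))                                ≡⟨ Φ-toProduct (x + y) ⟩
    x + y                                                ≡⟨ cong₂ _+_ (sym (Φ-toProduct x)) (sym (Φ-toProduct y)) ⟩
    (embed B₀ cx + πH x) + (embed B₀ cy + πH y)      ≡⟨ interchange _ _ _ _ ⟩
    (embed B₀ cx + embed B₀ cy) + (πH x + πH y)      ≡⟨ cong (_+ (πH x + πH y)) (sym (embed-+ B₀ B₀.orders cx cy)) ⟩
    embed B₀ (addCyc2 αs cx cy) + (πH x + πH y)          ∎)
    where
    open ≡-Reasoning
    cx = proj₁ (toProduct x)
    cy = proj₁ (toProduct y)

  G≅Cyc2Prod×oddPart : IsoToCyc2Prod G αs oddPart
  G≅Cyc2Prod×oddPart = record { φ = φ ; φ-hom = φ-hom }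

  order≡2^sum*d : order ≡ 2 ^ sum αs ℕ.* d
  order≡2^sum*d = ↔⇒≡ ((↔-sym Finₚ.*↔× ↔-∘ (Cyc2Prod↔Fin αs ×-↔ FinAbGroup.enum oddPart)) ↔-∘ (φ ↔-∘ ↔-sym enum))

  positive : ∀ {j} B → HasOrders j B → All (1 ≤_) (map proj₁ B)
  positive []      []                = []
  positive (_ ∷ B) ((1≤β , _) ∷ os) = 1≤β ∷ positive B os

  2·≡+ : ∀ x → 2 · x ≡ x + x
  2·≡+ x = cong (x +_) (identityʳ x)

  2·-+ : ∀ {u w} → 2 · u ≡ 0# → 2 · w ≡ 0# → 2 · (u + w) ≡ 0#
  2·-+ {u} {w} 2u≡0 2w≡0 = trans (×-distrib-+ u w 2) (trans (cong₂ _+_ 2u≡0 2w≡0) (identityˡ 0#))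

  2·embed-halves : ∀ B (os : HasOrders 0 B) {c} → c ∈ halves (map proj₁ B) (positive B os) → 2 · embed B c ≡ 0#
  2·embed-halves [] [] _ = ·-zeroʳ 2
  2·embed-halves ((suc β , y) ∷ B) ((s≤s z≤n , 2^[1+β]v≡0) ∷ os) c∈
    with ∈ₚ.∈-++⁻ (map (0 mod2^ suc β ,_) (halves (map proj₁ B) (positive B os))) c∈
  ... | inj₁ c∈₀ with ∈ₚ.∈-map⁻ (0 mod2^ suc β ,_) c∈₀
  ...   | cs , cs∈ , refl = 2·-+ 2·coordinate (2·embed-halves B os cs∈)
    where
    2·coordinate : 2 · (toℕ (0 mod2^ suc β) · (N 0 · y)) ≡ 0#
    2·coordinate = trans (cong (λ n → 2 · (n · (N 0 · y))) (toℕ-mod2^ (suc β) (ℕₚ.m^n>0 2 (suc β)))) (·-zeroʳ 2)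
  2·embed-halves ((suc β , y) ∷ B) ((s≤s z≤n , 2^[1+β]v≡0) ∷ os) c∈ | inj₂ c∈₁
    with ∈ₚ.∈-map⁻ (half β ,_) c∈₁
  ...   | cs , cs∈ , refl = 2·-+ 2·coordinate (2·embed-halves B os cs∈)
    where
    2·coordinate : 2 · (toℕ (half β) · (N 0 · y)) ≡ 0#
    2·coordinate = trans (cong (λ n → 2 · (n · (N 0 · y))) (toℕ-half β))
                         (trans (sym (·-assoc 2 (2 ^ β) _)) 2^[1+β]v≡0)

  Order≤2? : Decidable (λ x → 2 · x ≡ 0#)
  Order≤2? x = (2 · x) ≟ 0#

  #order≤2 : # Order≤2? ≡ 2 ^ length B₀
  #order≤2 = begin
    # Order≤2?                                ≡⟨ sym (length≡# Order≤2? embedded-unique sound complete) ⟩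
    length (map (embed B₀) (halves αs ps))    ≡⟨ Listₚ.length-map (embed B₀) (halves αs ps) ⟩
    length (halves αs ps)                     ≡⟨ length-halves αs ps ⟩
    2 ^ length αs                             ≡⟨ cong (2 ^_) (Listₚ.length-map proj₁ B₀) ⟩
    2 ^ length B₀                             ∎
    where
    open ≡-Reasoning
    ps = positive B₀ B₀.orders
    embedded-unique : Unique (map (embed B₀) (halves αs ps))
    embedded-unique = Uniqueₚ.map⁺ (embed-injective B₀ B₀.orders B₀.independent) (halves-unique αs ps)
    sound : ∀ {x} → x ∈ map (embed B₀) (halves αs ps) → 2 · x ≡ 0#
    sound x∈ with ∈ₚ.∈-map⁻ (embed B₀) x∈
    ... | c , c∈ , refl = 2·embed-halves B₀ B₀.orders c∈
    complete : ∀ {x} → 2 · x ≡ 0# → x ∈ map (embed B₀) (halves αs ps)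
    complete {x} 2x≡0 = subst (_∈ map (embed B₀) (halves αs ps)) (sym x≡embed)
      (∈ₚ.∈-map⁺ (embed B₀) (double≡zeros⇒∈halves αs ps c (embed-injective B₀ B₀.orders B₀.independent (begin
        embed B₀ (addCyc2 αs c c)   ≡⟨ embed-+ B₀ B₀.orders c c ⟩
        embed B₀ c + embed B₀ c     ≡⟨ cong (λ z → z + z) (sym x≡embed) ⟩
        x + x                       ≡⟨ sym (2·≡+ x) ⟩
        2 · x                       ≡⟨ 2x≡0 ⟩
        0#                          ≡⟨ sym (embed-zeros B₀ B₀.orders) ⟩
        embed B₀ (zeros αs)         ∎))))
      where
      c = proj₁ (toProduct x)
      πHx≡0 : πH x ≡ 0#
      πHx≡0 = odd·≡0∧2·≡0⇒≡0 D-odd (πH-InH x)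
        (trans (·-comm 2 (suc D ^ a) x) (trans (cong ((suc D ^ a) ·_) 2x≡0) (·-zeroʳ (suc D ^ a))))
      x≡embed : x ≡ embed B₀ c
      x≡embed = trans (sym (Φ-toProduct x)) (trans (cong (embed B₀ c +_) πHx≡0) (identityʳ _))

  1+numInvolutions≡#order≤2 : suc numInvolutions ≡ # Order≤2?
  1+numInvolutions≡#order≤2 = length≡# Order≤2? {0# ∷ filter isInvolution? elements}
    (All.tabulate (λ x∈ x≡0 → proj₁ (proj₂ (∈ₚ.∈-filter⁻ isInvolution? {xs = elements} x∈)) (sym x≡0))
      ∷ Uniqueₚ.filter⁺ isInvolution? elements-unique)
    sound complete
    where
    sound : ∀ {x} → x ∈ 0# ∷ filter isInvolution? elements → 2 · x ≡ 0#
    sound (here refl) = ·-zeroʳ 2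
    sound {x} (there x∈) = trans (2·≡+ x) (proj₂ (proj₂ (∈ₚ.∈-filter⁻ isInvolution? {xs = elements} x∈)))
    complete : ∀ {x} → 2 · x ≡ 0# → x ∈ 0# ∷ filter isInvolution? elements
    complete {x} 2x≡0 with x ≟ 0#
    ... | yes refl = here refl
    ... | no x≢0   = there (∈ₚ.∈-filter⁺ isInvolution? (∈-elements x) (x≢0 , trans (sym (2·≡+ x)) 2x≡0))

  -- Lagrange's theorem in H

  module _ {R : Carrier → Carrier → Set} (R? : ∀ x → Decidable (R x))
           (R-refl : ∀ {x} → R x x) (R-sym : ∀ {x y} → R x y → R y x)
           (R-trans : ∀ {x y z} → R x y → R y z → R x z) (k : ℕ) where

    equal-classes⇒∣ : ∀ {T : Carrier → Set} (T? : Decidable T) →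
      (∀ {x y} → T x → R x y → T y) → (∀ {t} → T t → # (R? t) ≡ k) → k ∣ # T?
    equal-classes⇒∣ T? = go T? (<-wellFounded (# T?))
      where
      go : ∀ {T : Carrier → Set} (T? : Decidable T) → Acc _<_ (# T?) →
        (∀ {x y} → T x → R x y → T y) → (∀ {t} → T t → # (R? t) ≡ k) → k ∣ # T?
      go T? _ closed sizes with any? T? elements
      ... | no none = subst (k ∣_) (sym (cong length (Listₚ.filter-none T? (Allₚ.¬Any⇒All¬ elements none))))
                        (k ℕ∣.∣0)
      go {T} T? (acc rec) closed sizes | yes some with Any.satisfied some
      ... | t , tT = subst (k ∣_) (sym #T≡) (ℕ∣.∣m∣n⇒∣m+n (subst (k ∣_) (sym #class≡k) ℕ∣.∣-refl) rest-divisible)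
        where
        class? rest? : Decidable _
        class? x = T? x ×-dec R? t x
        rest?  x = T? x ×-dec ¬? (R? t x)
        #T≡ : # T? ≡ # class? ℕ.+ # rest?
        #T≡ = length-filter-split T? (R? t) elements
        #class≡k : # class? ≡ k
        #class≡k = trans (length-filter-≐ class? (R? t) elements proj₂ (λ r → closed tT r , r)) (sizes tT)
        0<#class : 0 < # class?
        0<#class = Listₚ.filter-some class? (Any.map (λ { refl → tT , R-refl }) (∈-elements t))
        rest-divisible : k ∣ # rest?
        rest-divisible = go rest? (rec (subst (# rest? <_) (sym #T≡) (ℕₚ.m<n+m (# rest?) 0<#class)))
          (λ (Tx , ¬Rtx) Rxy → closed Tx Rxy , λ Rty → ¬Rtx (R-trans Rty (R-sym Rxy)))
          (sizes ∘ proj₁)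

  _≡±_ : Carrier → Carrier → Set
  x ≡± y = y ≡ x ⊎ y ≡ - x

  ≡±? : ∀ x → Decidable (x ≡±_)
  ≡±? x y = (y ≟ x) ⊎-dec (y ≟ (- x))

  ≡±-sym : ∀ {x y} → x ≡± y → y ≡± x
  ≡±-sym (inj₁ refl) = inj₁ refl
  ≡±-sym (inj₂ refl) = inj₂ (sym (⁻¹-involutive _))

  ≡±-trans : ∀ {x y z} → x ≡± y → y ≡± z → x ≡± z
  ≡±-trans (inj₁ refl) y≡±z         = y≡±z
  ≡±-trans (inj₂ refl) (inj₁ refl) = inj₂ refl
  ≡±-trans (inj₂ refl) (inj₂ refl) = inj₁ (⁻¹-involutive _)

  -- The nonzero elements of H pair off as {x , - x}: x = - x would mean 2 x = 0, impossible as D is odd.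
  d-odd : Odd d
  d-odd = ℕ∣.quotient 2∣#H∖0 , (begin
    d                                ≡⟨ length-filter-split InH? (_≟ 0#) elements ⟩
    # H∩0? ℕ.+ # H∖0?                ≡⟨ cong₂ ℕ._+_ #H∩0≡1 (ℕ∣.m∣n⇒n≡m*quotient 2∣#H∖0) ⟩
    suc (2 ℕ.* ℕ∣.quotient 2∣#H∖0)   ∎)
    where
    open ≡-Reasoning
    H∩0? H∖0? : Decidable _
    H∩0? x = InH? x ×-dec (x ≟ 0#)
    H∖0? x = InH? x ×-dec ¬? (x ≟ 0#)
    #H∩0≡1 : # H∩0? ≡ 1
    #H∩0≡1 = sym (length≡# H∩0? {0# ∷ []} ([] ∷ []) (λ { (here refl) → InH-0 , refl }) (λ { (_ , refl) → here refl }))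
    closed : ∀ {x y} → InH x × x ≢ 0# → x ≡± y → InH y × y ≢ 0#
    closed x∈ (inj₁ refl) = x∈
    closed {x} (x∈H , x≢0) (inj₂ refl) = InH-- x∈H , λ -x≡0 → x≢0 (⁻¹-injective (trans -x≡0 (sym ε⁻¹≈ε)))
    size : ∀ {t} → InH t × t ≢ 0# → # (≡±? t) ≡ 2
    size {t} (t∈H , t≢0) = sym (length≡# (≡±? t) {t ∷ - t ∷ []} ((t≢-t ∷ []) ∷ [] ∷ [])
      (λ { (here refl) → inj₁ refl ; (there (here refl)) → inj₂ refl })
      (λ { (inj₁ refl) → here refl ; (inj₂ refl) → there (here refl) }))
      where
      t≢-t : t ≢ - t
      t≢-t t≡-t = t≢0 (odd·≡0∧2·≡0⇒≡0 D-odd t∈H (trans (2·≡+ t) (trans (cong (t +_) t≡-t) (inverseʳ t))))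
    2∣#H∖0 : 2 ∣ # H∖0?
    2∣#H∖0 = equal-classes⇒∣ ≡±? (inj₁ refl) ≡±-sym ≡±-trans 2 H∖0? closed size

  lagrange : ∀ {K : Carrier → Set} (K? : Decidable K) → K 0# → (∀ {x y} → K x → K y → K (x + y)) →
    (∀ {x} → K x → K (- x)) → (∀ {x} → K x → InH x) → # K? ∣ d
  lagrange {K} K? K0 K+ K- K⊆H = equal-classes⇒∣ coset? K0′ R-sym R-trans (# K?) InH? closed size
    where
    coset? : ∀ x → Decidable (λ y → K (y - x))
    coset? x y = K? (y - x)
    K0′ : ∀ {x} → K (x - x)
    K0′ {x} = subst K (sym (inverseʳ x)) K0
    R-sym : ∀ {x y} → K (y - x) → K (x - y)
    R-sym {x} {y} Ky-x = subst K (⁻¹-anti-homo‿- y x) (K- Ky-x)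
    R-trans : ∀ {x y z} → K (y - x) → K (z - y) → K (z - x)
    R-trans {x} {y} {z} Ky-x Kz-y = subst K (x-y+[y-z]≡x-z z y x) (K+ Kz-y Ky-x)
    closed : ∀ {x y} → InH x → K (y - x) → InH y
    closed {x} {y} x∈H Ky-x = subst InH (x-y+y≡x y x) (InH-+ (K⊆H Ky-x) x∈H)
    size : ∀ {t} → InH t → # (coset? t) ≡ # K?
    size {t} _ = trans (sym (length≡# (coset? t) {map (t +_) (filter K? elements)}
        (Uniqueₚ.map⁺ (∙-cancelˡ t _ _) (Uniqueₚ.filter⁺ K? elements-unique)) sound complete))
      (Listₚ.length-map (t +_) (filter K? elements))
      where
      sound : ∀ {y} → y ∈ map (t +_) (filter K? elements) → K (y - t)
      sound y∈ with ∈ₚ.∈-map⁻ (t +_) y∈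
      ... | k , k∈ , refl = subst K (sym (xyx⁻¹≈y t k)) (proj₂ (∈ₚ.∈-filter⁻ K? {xs = elements} k∈))
      complete : ∀ {y} → K (y - t) → y ∈ map (t +_) (filter K? elements)
      complete {y} Ky-t = subst (_∈ map (t +_) (filter K? elements)) (trans (comm t _) (x-y+y≡x y t))
        (∈ₚ.∈-map⁺ (t +_) (∈ₚ.∈-filter⁺ K? (∈-elements (y - t)) Ky-t))

  3·≡0⇒InH : ∀ {x} → 3 · x ≡ 0# → InH x
  3·≡0⇒InH {x} 3x≡0 = odd·≡0∧2^·≡0⇒≡0 a (1 , refl)
    (trans (·-comm 3 D x) (trans (cong (D ·_) 3x≡0) (·-zeroʳ D))) (InP-D· x)

  ·≡·⇒+∸·≡0 : ∀ {x} (i j : Fin 3) → 3 · x ≡ 0# → toℕ i · x ≡ toℕ j · x → (toℕ i ℕ.+ (3 ∸ toℕ j)) · x ≡ 0#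
  ·≡·⇒+∸·≡0 i j 3x≡0 ix≡jx =
    trans (+∸·≡- (toℕ i) (toℕ j) 3x≡0 (ℕₚ.<⇒≤ (Finₚ.toℕ<n j))) (x≈y⇒x∙y⁻¹≈ε ix≡jx)

  toℕ-mod3-· : ∀ {x} i → 3 · x ≡ 0# → toℕ (i mod 3) · x ≡ i · x
  toℕ-mod3-· {x} i 3x≡0 = trans (cong (_· x) (Finₚ.toℕ-fromℕ< (m%n<n i 3))) (sym (·-mod i 3x≡0))

  module _ {x} (3x≡0 : 3 · x ≡ 0#) (x≢0 : x ≢ 0#) where

    ·≡0⇒3∣ : ∀ A → A · x ≡ 0# → 3 ∣ A
    ·≡0⇒3∣ A Ax≡0 with residue-3 A | ·-mod {3} A 3x≡0
    ... | inj₁ A%3≡0        | _ = ℕ∣.m%n≡0⇒n∣m A 3 A%3≡0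
    ... | inj₂ (inj₁ A%3≡1) | Ax≡[A%3]x =
      ⊥-elim (x≢0 (trans (sym (×-homo-1 x)) (trans (cong (_· x) (sym A%3≡1)) (trans (sym Ax≡[A%3]x) Ax≡0))))
    ... | inj₂ (inj₂ A%3≡2) | Ax≡[A%3]x = ⊥-elim (x≢0 (begin
      x              ≡⟨ sym (identityʳ x) ⟩
      x + 0#         ≡⟨ cong (x +_) (sym (trans (cong (_· x) (sym A%3≡2)) (trans (sym Ax≡[A%3]x) Ax≡0))) ⟩
      3 · x          ≡⟨ 3x≡0 ⟩
      0#             ∎))
      where open ≡-Reasoning

    Multiple : Carrier → Set
    Multiple z = ∃[ i ] z ≡ i · x

    multiples : List Carrier
    multiples = map (λ i → toℕ i · x) (allFin 3)

    multiples-sound : ∀ {z} → z ∈ multiples → Multiple z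
    multiples-sound z∈ with ∈ₚ.∈-map⁻ (λ i → toℕ i · x) {xs = allFin 3} z∈
    ... | i , _ , z≡ix = toℕ i , z≡ix

    multiples-complete : ∀ {z} → Multiple z → z ∈ multiples
    multiples-complete (i , refl) = subst (_∈ multiples) (toℕ-mod3-· i 3x≡0)
      (∈ₚ.∈-map⁺ (λ i → toℕ i · x) (∈ₚ.∈-allFin (i mod 3)))

    Multiple? : Decidable Multiple
    Multiple? z = map′ multiples-sound multiples-complete (z ∈? multiples)

    #Multiple≡3 : # Multiple? ≡ 3
    #Multiple≡3 = sym (length≡# Multiple? {multiples}
      (Uniqueₚ.map⁺ (λ {i} {j} ix≡jx → Fin-∣+∸⇒≡ i j (·≡0⇒3∣ _ (·≡·⇒+∸·≡0 i j 3x≡0 ix≡jx))) (Uniqueₚ.allFin⁺ 3))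
      multiples-sound multiples-complete)

    order-3⇒3∣d : 3 ∣ d
    order-3⇒3∣d = subst (_∣ d) #Multiple≡3 (lagrange Multiple? (0 , refl)
      (λ { (i , refl) (j , refl) → i ℕ.+ j , sym (×-homo-+ x i j) })
      (λ { (i , refl) → (E ∸ 1) ℕ.* i , trans (-≡[E∸1]· _) (sym (·-assoc (E ∸ 1) i x)) })
      (λ { (i , refl) → InH-· i (3·≡0⇒InH 3x≡0) }))

    module _ {y} (3y≡0 : 3 · y ≡ 0#) (y∉⟨x⟩ : ∀ k → y ≢ k · x) where

      ·+·≡0⇒3∣ : ∀ A B → A · x + B · y ≡ 0# → 3 ∣ A × 3 ∣ B
      ·+·≡0⇒3∣ A B Ax+By≡0 with residue-3 B | ·-mod {3} B 3y≡0
      ... | inj₁ B%3≡0 | By≡[B%3]y = ·≡0⇒3∣ A Ax≡0 , ℕ∣.m%n≡0⇒n∣m B 3 B%3≡0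
        where
        Ax≡0 : A · x ≡ 0#
        Ax≡0 = trans (sym (identityʳ _)) (trans (cong (A · x +_) (sym (trans By≡[B%3]y (cong (_· y) B%3≡0)))) Ax+By≡0)
      ... | inj₂ (inj₁ B%3≡1) | By≡[B%3]y = ⊥-elim (y∉⟨x⟩ ((E ∸ 1) ℕ.* A) (begin
        y                        ≡⟨ inverseʳ-unique _ _ (trans (cong (A · x +_) (sym By≡y)) Ax+By≡0) ⟩
        - (A · x)                ≡⟨ -≡[E∸1]· _ ⟩
        (E ∸ 1) · (A · x)        ≡⟨ sym (·-assoc (E ∸ 1) A x) ⟩
        ((E ∸ 1) ℕ.* A) · x      ∎))
        where
        open ≡-Reasoning
        By≡y : B · y ≡ y
        By≡y = trans By≡[B%3]y (trans (cong (_· y) B%3≡1) (×-homo-1 y))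
      -- 2 y = - y because 3 y = 0, so A x + 2 y = 0 puts y in ⟨x⟩
      ... | inj₂ (inj₂ B%3≡2) | By≡[B%3]y = ⊥-elim (y∉⟨x⟩ A (begin
        y                 ≡⟨ sym (×-homo-1 y) ⟩
        1 · y             ≡⟨ ⁻¹-injective (trans (sym (∸·≡- {3} 1 3y≡0 (s≤s z≤n))) 2y≡-Ax) ⟩
        A · x             ∎))
        where
        open ≡-Reasoning
        2y≡-Ax : 2 · y ≡ - (A · x)
        2y≡-Ax = inverseʳ-unique _ _ (trans (cong (A · x +_) (sym (trans By≡[B%3]y (cong (_· y) B%3≡2)))) Ax+By≡0)

      Combination : Carrier → Set
      Combination z = ∃[ i ] ∃[ j ] z ≡ i · x + j · y

      combination : Fin 3 × Fin 3 → Carrier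
      combination (i , j) = toℕ i · x + toℕ j · y

      combinations : List Carrier
      combinations = map combination (cartesianProduct (allFin 3) (allFin 3))

      combinations-sound : ∀ {z} → z ∈ combinations → Combination z
      combinations-sound z∈ with ∈ₚ.∈-map⁻ combination {xs = cartesianProduct (allFin 3) (allFin 3)} z∈
      ... | (i , j) , _ , z≡ = toℕ i , toℕ j , z≡

      combinations-complete : ∀ {z} → Combination z → z ∈ combinations
      combinations-complete (i , j , refl) =
        subst (_∈ combinations) (cong₂ _+_ (toℕ-mod3-· i 3x≡0) (toℕ-mod3-· j 3y≡0))
          (∈ₚ.∈-map⁺ combination (∈ₚ.∈-cartesianProduct⁺ (∈ₚ.∈-allFin (i mod 3)) (∈ₚ.∈-allFin (j mod 3))))

      Combination? : Decidable Combination
      Combination? z = map′ combinations-sound combinations-complete (z ∈? combinations)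

      combination-injective : ∀ {p q} → combination p ≡ combination q → p ≡ q
      combination-injective {i , j} {i′ , j′} eq with ·+·≡0⇒3∣ (toℕ i ℕ.+ (3 ∸ toℕ i′)) (toℕ j ℕ.+ (3 ∸ toℕ j′)) (begin
          (toℕ i ℕ.+ (3 ∸ toℕ i′)) · x + (toℕ j ℕ.+ (3 ∸ toℕ j′)) · y
            ≡⟨ cong₂ _+_ (+∸·≡- (toℕ i) (toℕ i′) 3x≡0 (ℕₚ.<⇒≤ (Finₚ.toℕ<n i′)))
                         (+∸·≡- (toℕ j) (toℕ j′) 3y≡0 (ℕₚ.<⇒≤ (Finₚ.toℕ<n j′))) ⟩
          (toℕ i · x - toℕ i′ · x) + (toℕ j · y - toℕ j′ · y)
            ≡⟨ interchange _ _ _ _ ⟩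
          combination (i , j) + (- (toℕ i′ · x) + - (toℕ j′ · y))
            ≡⟨ cong (combination (i , j) +_) (⁻¹-∙-comm _ _) ⟩
          combination (i , j) - combination (i′ , j′)
            ≡⟨ x≈y⇒x∙y⁻¹≈ε eq ⟩
          0# ∎)
        where open ≡-Reasoning
      ... | 3∣i-i′ , 3∣j-j′ = cong₂ _,_ (Fin-∣+∸⇒≡ i i′ 3∣i-i′) (Fin-∣+∸⇒≡ j j′ 3∣j-j′)

      #Combination≡9 : # Combination? ≡ 9
      #Combination≡9 = sym (length≡# Combination? {combinations}
        (Uniqueₚ.map⁺ combination-injective (Uniqueₚ.cartesianProduct⁺ (Uniqueₚ.allFin⁺ 3) (Uniqueₚ.allFin⁺ 3)))
        combinations-sound combinations-complete)

      two-order-3⇒9∣d : 9 ∣ d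
      two-order-3⇒9∣d = subst (_∣ d) #Combination≡9 (lagrange Combination? (0 , 0 , sym (identityˡ 0#))
        (λ { (i , j , refl) (i′ , j′ , refl) → i ℕ.+ i′ , j ℕ.+ j′ ,
               trans (interchange _ _ _ _) (sym (cong₂ _+_ (×-homo-+ x i i′) (×-homo-+ y j j′))) })
        (λ { (i , j , refl) → (E ∸ 1) ℕ.* i , (E ∸ 1) ℕ.* j ,
               trans (sym (⁻¹-∙-comm _ _)) (cong₂ _+_ (trans (-≡[E∸1]· _) (sym (·-assoc (E ∸ 1) i x)))
                                                    (trans (-≡[E∸1]· _) (sym (·-assoc (E ∸ 1) j y)))) })
        (λ { (i , j , refl) → InH-+ (InH-· i (3·≡0⇒InH 3x≡0)) (InH-· j (3·≡0⇒InH 3y≡0)) }))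

  -- Partial spreads and the count |G| = 1 + f + 2e + 6|𝒯|

  ∑ : List Carrier → Carrier
  ∑ = foldr _+_ 0#

  ∑-map-+ : ∀ x xs → ∑ (map (_+ x) xs) ≡ ∑ xs + length xs · x
  ∑-map-+ x []       = sym (identityˡ 0#)
  ∑-map-+ x (y ∷ xs) = trans (cong ((y + x) +_) (∑-map-+ x xs)) (interchange y x _ _)

  ∑-↭ : ∀ {xs ys} → xs ↭ ys → ∑ xs ≡ ∑ ys
  ∑-↭ xs↭ys = foldr-commMonoid (AbelianGroup.isCommutativeMonoid abelianGroup) (↭⇒↭ₛ xs↭ys)

  ∃≢0 : ∀ {xs} → Unique xs → 2 ≤ length xs → ∃[ x ] (x ∈ xs × x ≢ 0#)
  ∃≢0 {x₁ ∷ x₂ ∷ _} ((x₁≢x₂ ∷ _) ∷ _) _ with x₁ ≟ 0#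
  ... | yes refl = x₂ , there (here refl) , x₁≢x₂ ∘ sym
  ... | no x₁≢0  = x₁ , here refl , x₁≢0
  ∃≢0 {_ ∷ []} _ (s≤s ())

  module _ (S : Subgroup G) where
    open Subgroup S

    -- translation by x ∈ S permutes S, so ∑ S = ∑ S + |S| x
    ord·≡0 : ∀ {x} → x ∈ elems → ord · x ≡ 0#
    ord·≡0 {x} x∈S = ∙-cancelˡ (∑ elems) _ _
      (trans (sym (∑-map-+ x elems)) (trans (∑-↭ translate↭) (sym (identityʳ _))))
      where
      translate↭ : map (_+ x) elems ↭ elems
      translate↭ = ∼bag⇒↭ (unique∧set⇒bag (Uniqueₚ.map⁺ (∙-cancelʳ x _ _) unique) unique (mk⇔
        (λ y∈ → case ∈ₚ.∈-map⁻ (_+ x) y∈ of λ { (s , s∈ , refl) → closed+ s∈ x∈S })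
        (λ y∈ → subst (_∈ map (_+ x) elems) (x-y+y≡x _ x) (∈ₚ.∈-map⁺ (_+ x) (closed+ y∈ (closed- x∈S))))))

    ·∈ : ∀ {x} k → x ∈ elems → k · x ∈ elems
    ·∈ zero    _   = has-0
    ·∈ (suc k) x∈S = closed+ x∈S (·∈ k x∈S)

    order-3-element : ord ≡ 3 → ∃[ x ] (x ∈ elems × x ≢ 0# × 3 · x ≡ 0#)
    order-3-element ord≡3 with ∃≢0 unique (subst (2 ≤_) (sym ord≡3) (s≤s (s≤s z≤n)))
    ... | x , x∈S , x≢0 = x , x∈S , x≢0 , subst (λ n → n · x ≡ 0#) ord≡3 (ord·≡0 x∈S)

  count-∷-≡ : ∀ x xs → count x (x ∷ xs) ≡ suc (count x xs)
  count-∷-≡ x xs = cong length (Listₚ.filter-accept (x ≟_) refl)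

  count-∷-≢ : ∀ {x y} xs → x ≢ y → count x (y ∷ xs) ≡ count x xs
  count-∷-≢ xs x≢y = cong length (Listₚ.filter-reject (_ ≟_) x≢y)

  ∈⇒0<count : ∀ {x xs} → x ∈ xs → 0 < count x xs
  ∈⇒0<count {x} = Listₚ.filter-some (x ≟_)

  count≤1⇒unique : ∀ xs → (∀ x → count x xs ≤ 1) → Unique xs
  count≤1⇒unique []       _       = []
  count≤1⇒unique (y ∷ xs) count≤1 =
    All.tabulate (λ z∈ y≡z → ℕₚ.<⇒≱ (s≤s (∈⇒0<count (subst (_∈ xs) (sym y≡z) z∈)))
                                    (subst (_≤ 1) (count-∷-≡ y xs) (count≤1 y)))
    ∷ count≤1⇒unique xs (λ x → ℕₚ.≤-trans (count-≤-∷ x) (count≤1 x))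
    where
    count-≤-∷ : ∀ x → count x xs ≤ count x (y ∷ xs)
    count-≤-∷ x = case x ≟ y of λ where
      (yes refl) → subst (count x xs ≤_) (sym (count-∷-≡ x xs)) (ℕₚ.n≤1+n _)
      (no x≢y)   → ℕₚ.≤-reflexive (sym (count-∷-≢ xs x≢y))

  unique⇒count≡1 : ∀ {x xs} → Unique xs → x ∈ xs → count x xs ≡ 1
  unique⇒count≡1 {x} {_ ∷ xs} (x∉xs ∷ _) (here refl) =
    trans (count-∷-≡ x xs) (cong (suc ∘ length) (Listₚ.filter-none (x ≟_) x∉xs))
  unique⇒count≡1 {x} {y ∷ xs} (y∉xs ∷ u) (there x∈xs) =
    trans (count-∷-≢ xs (λ x≡y → All.lookup y∉xs x∈xs (sym x≡y))) (unique⇒count≡1 u x∈xs)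

  0<count⇒∈ : ∀ {x xs} → 0 < count x xs → x ∈ xs
  0<count⇒∈ {x} {xs} 0<count with index-filter (x ≟_) xs 0<count
  ... | i , x≡xsᵢ = subst (_∈ xs) (sym x≡xsᵢ) (∈ₚ.∈-lookup i)

  IsPartialSpread-tail : ∀ {S 𝒮} → IsPartialSpread G (S ∷ 𝒮) → IsPartialSpread G 𝒮
  IsPartialSpread-tail spread i j i≢j = spread (Fin.suc i) (Fin.suc j) (i≢j ∘ Finₚ.suc-injective)

  IsPartialSpread-head : ∀ {S 𝒮 x} → IsPartialSpread G (S ∷ 𝒮) →
    x ∈ Subgroup.elems S → InUnion G 𝒮 x → x ≡ 0#
  IsPartialSpread-head spread x∈S x∈⋃ =
    spread Fin.zero (Fin.suc (Any.index x∈⋃)) (λ ()) _ x∈S (lookup-index x∈⋃)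

  InUnion? : ∀ 𝒮 → Decidable (InUnion G 𝒮)
  InUnion? 𝒮 x = any? (λ S → x ∈? Subgroup.elems S) 𝒮

  nonzeros : Subgroup G → List Carrier
  nonzeros S = filter (¬? ∘ (0# ≟_)) (Subgroup.elems S)

  length-nonzeros : ∀ S → length (nonzeros S) ≡ Subgroup.ord S ∸ 1
  length-nonzeros S = sym (cong (_∸ 1) (trans (length-filter-¬ (0# ≟_) (Subgroup.elems S))
    (cong (ℕ._+ length (nonzeros S)) (unique⇒count≡1 (Subgroup.unique S) (Subgroup.has-0 S)))))

  spreadList : List (Subgroup G) → List Carrier
  spreadList = concatMap nonzeros

  ∈-spreadList⁺ : ∀ 𝒮 {x} → InUnion G 𝒮 x → x ≢ 0# → x ∈ spreadList 𝒮
  ∈-spreadList⁺ 𝒮 x∈⋃ x≢0 =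
    ∈ₚ.∈-concatMap⁺ nonzeros (Any.map (λ x∈S → ∈ₚ.∈-filter⁺ (¬? ∘ (0# ≟_)) x∈S (x≢0 ∘ sym)) x∈⋃)

  ∈-nonzeros⁻ : ∀ S {x} → x ∈ nonzeros S → x ∈ Subgroup.elems S × x ≢ 0#
  ∈-nonzeros⁻ S x∈ with ∈ₚ.∈-filter⁻ (¬? ∘ (0# ≟_)) {xs = Subgroup.elems S} x∈
  ... | x∈S , 0≢x = x∈S , 0≢x ∘ sym

  ∈-spreadList⁻ : ∀ 𝒮 {x} → x ∈ spreadList 𝒮 → InUnion G 𝒮 x × x ≢ 0#
  ∈-spreadList⁻ 𝒮 x∈ with ∈ₚ.∈-concatMap⁻ nonzeros {xs = 𝒮} x∈
  ... | x∈⋃* with Any.satisfied x∈⋃*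
  ...   | S , x∈S* = Any.map (λ {S} → proj₁ ∘ ∈-nonzeros⁻ S) x∈⋃* , proj₂ (∈-nonzeros⁻ S x∈S*)

  spreadList-unique : ∀ 𝒮 → IsPartialSpread G 𝒮 → Unique (spreadList 𝒮)
  spreadList-unique []      _      = []
  spreadList-unique (S ∷ 𝒮) spread = Uniqueₚ.++⁺ (Uniqueₚ.filter⁺ (¬? ∘ (0# ≟_)) (Subgroup.unique S))
    (spreadList-unique 𝒮 (IsPartialSpread-tail spread))
    (λ (x∈S* , x∈rest) → let x∈S , x≢0 = ∈-nonzeros⁻ S x∈S* in
      x≢0 (IsPartialSpread-head spread x∈S (proj₁ (∈-spreadList⁻ 𝒮 x∈rest))))

  length-spreadList : ∀ 𝒮 → All (λ S → Subgroup.ord S ≡ 2 ⊎ Subgroup.ord S ≡ 3) 𝒮 →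
    length (spreadList 𝒮)
      ≡ length (filter (λ S → Subgroup.ord S ℕ.≟ 2) 𝒮) ℕ.+ 2 ℕ.* length (filter (λ S → Subgroup.ord S ℕ.≟ 3) 𝒮)
  length-spreadList []      []         = refl
  length-spreadList (S ∷ 𝒮) (ord≡ ∷ ords) = begin
    length (nonzeros S ++ spreadList 𝒮)        ≡⟨ Listₚ.length-++ (nonzeros S) ⟩
    length (nonzeros S) ℕ.+ length (spreadList 𝒮)
      ≡⟨ cong₂ ℕ._+_ (length-nonzeros S) (length-spreadList 𝒮 ords) ⟩
    (Subgroup.ord S ∸ 1) ℕ.+ (f ℕ.+ 2 ℕ.* e)   ≡⟨ step ord≡ ⟩
    length (filter ord≟2 (S ∷ 𝒮)) ℕ.+ 2 ℕ.* length (filter ord≟3 (S ∷ 𝒮)) ∎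
    where
    open ≡-Reasoning
    ord≟2 : Decidable (λ (S : Subgroup G) → Subgroup.ord S ≡ 2)
    ord≟3 : Decidable (λ (S : Subgroup G) → Subgroup.ord S ≡ 3)
    ord≟2 S = Subgroup.ord S ℕ.≟ 2
    ord≟3 S = Subgroup.ord S ℕ.≟ 3
    f = length (filter ord≟2 𝒮)
    e = length (filter ord≟3 𝒮)
    regroup : ∀ f e → 2 ℕ.+ (f ℕ.+ 2 ℕ.* e) ≡ f ℕ.+ 2 ℕ.* (1 ℕ.+ e)
    regroup = solve-∀
    step : Subgroup.ord S ≡ 2 ⊎ Subgroup.ord S ≡ 3 →
      (Subgroup.ord S ∸ 1) ℕ.+ (f ℕ.+ 2 ℕ.* e)
        ≡ length (filter ord≟2 (S ∷ 𝒮)) ℕ.+ 2 ℕ.* length (filter ord≟3 (S ∷ 𝒮))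
    2≢3 : 2 ≢ 3
    2≢3 ()
    lengths : ∀ {fs es} → filter ord≟2 (S ∷ 𝒮) ≡ fs → filter ord≟3 (S ∷ 𝒮) ≡ es →
      length fs ℕ.+ 2 ℕ.* length es ≡ length (filter ord≟2 (S ∷ 𝒮)) ℕ.+ 2 ℕ.* length (filter ord≟3 (S ∷ 𝒮))
    lengths fs≡ es≡ = sym (cong₂ (λ fs es → length fs ℕ.+ 2 ℕ.* length es) fs≡ es≡)
    step (inj₁ ord≡2) = trans (cong (λ n → (n ∸ 1) ℕ.+ (f ℕ.+ 2 ℕ.* e)) ord≡2)
      (lengths (Listₚ.filter-accept ord≟2 {x = S} {xs = 𝒮} ord≡2)
               (Listₚ.filter-reject ord≟3 {x = S} {xs = 𝒮} (2≢3 ∘ trans (sym ord≡2))))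
    step (inj₂ ord≡3) = trans (cong (λ n → (n ∸ 1) ℕ.+ (f ℕ.+ 2 ℕ.* e)) ord≡3) (trans (regroup f e)
      (lengths (Listₚ.filter-reject ord≟2 {x = S} {xs = 𝒮} (λ ord≡2 → 2≢3 (trans (sym ord≡2) ord≡3)))
               (Listₚ.filter-accept ord≟3 {x = S} {xs = 𝒮} ord≡3)))

  #InUnion : ∀ 𝒮 → IsPartialSpread G 𝒮 → 1 ≤ length 𝒮 → # (InUnion? 𝒮) ≡ suc (length (spreadList 𝒮))
  #InUnion 𝒮@(S ∷ _) spread _ = begin
    # (InUnion? 𝒮)                ≡⟨ length-filter-split (InUnion? 𝒮) (_≟ 0#) elements ⟩
    # zero? ℕ.+ # nonzero?        ≡⟨ cong₂ ℕ._+_ #zero≡1 (sym #nonzero≡) ⟩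
    suc (length (spreadList 𝒮))   ∎
    where
    open ≡-Reasoning
    zero? nonzero? : Decidable _
    zero?    x = InUnion? 𝒮 x ×-dec (x ≟ 0#)
    nonzero? x = InUnion? 𝒮 x ×-dec ¬? (x ≟ 0#)
    #zero≡1 : # zero? ≡ 1
    #zero≡1 = sym (length≡# zero? {0# ∷ []} ([] ∷ [])
      (λ { (here refl) → here (Subgroup.has-0 S) , refl }) (λ { (_ , refl) → here refl }))
    #nonzero≡ : length (spreadList 𝒮) ≡ # nonzero?
    #nonzero≡ = length≡# nonzero? (spreadList-unique 𝒮 spread)
      (∈-spreadList⁻ 𝒮) (λ (x∈⋃ , x≢0) → ∈-spreadList⁺ 𝒮 x∈⋃ x≢0)

  length-ΔFamily : ∀ 𝒯 → length (ΔFamily G 𝒯) ≡ 6 ℕ.* length 𝒯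
  length-ΔFamily []      = refl
  length-ΔFamily (T ∷ 𝒯) = trans (Listₚ.length-++ (ΔTriple G T) {ΔFamily G 𝒯})
    (trans (cong (6 ℕ.+_) (length-ΔFamily 𝒯)) (sym (ℕₚ.*-suc 6 (length 𝒯))))

  -- Δ𝒯 lists the complement of the union, each element exactly once
  #∉Union : ∀ 𝒮 𝒯 → IsDiffFamily G 𝒮 𝒯 → # (¬? ∘ InUnion? 𝒮) ≡ 6 ℕ.* length 𝒯
  #∉Union 𝒮 𝒯 diffFamily =
    trans (sym (length≡# (¬? ∘ InUnion? 𝒮) (count≤1⇒unique (ΔFamily G 𝒯) count≤1) sound complete))
          (length-ΔFamily 𝒯)
    where
    count≤1 : ∀ x → count x (ΔFamily G 𝒯) ≤ 1
    count≤1 x = case InUnion? 𝒮 x of λ where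
      (yes x∈⋃) → ℕₚ.≤-trans (ℕₚ.≤-reflexive (proj₁ (diffFamily x) x∈⋃)) z≤n
      (no x∉⋃)  → ℕₚ.≤-reflexive (proj₂ (diffFamily x) x∉⋃)
    sound : ∀ {x} → x ∈ ΔFamily G 𝒯 → ¬ InUnion G 𝒮 x
    sound {x} x∈Δ x∈⋃ = ℕₚ.<⇒≢ (∈⇒0<count x∈Δ) (sym (proj₁ (diffFamily x) x∈⋃))
    complete : ∀ {x} → ¬ InUnion G 𝒮 x → x ∈ ΔFamily G 𝒯
    complete {x} x∉⋃ = 0<count⇒∈ (ℕₚ.≤-reflexive (sym (proj₂ (diffFamily x) x∉⋃)))

  order≡1+f+2e+6t : ∀ {𝒮 𝒯 f e} → IsPartialSpread G 𝒮 → HasType23 G 𝒮 f e → IsDiffFamily G 𝒮 𝒯 → 1 ≤ f →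
    order ≡ suc (f ℕ.+ 2 ℕ.* e) ℕ.+ 6 ℕ.* length 𝒯
  order≡1+f+2e+6t {𝒮} {𝒯} {f} {e} spread (ords , #2≡f , #3≡e) diffFamily 1≤f = begin
    order
      ≡⟨ sym (trans (Listₚ.length-map _ (allFin order)) (Listₚ.length-tabulate id)) ⟩
    length elements
      ≡⟨ length-filter-¬ (InUnion? 𝒮) elements ⟩
    # (InUnion? 𝒮) ℕ.+ # (¬? ∘ InUnion? 𝒮)
      ≡⟨ cong₂ ℕ._+_ (#InUnion 𝒮 spread 1≤|𝒮|) (#∉Union 𝒮 𝒯 diffFamily) ⟩
    suc (length (spreadList 𝒮)) ℕ.+ 6 ℕ.* length 𝒯
      ≡⟨ cong (λ n → suc n ℕ.+ 6 ℕ.* length 𝒯) (length-spreadList 𝒮 ords) ⟩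
    suc (#2 ℕ.+ 2 ℕ.* #3) ℕ.+ 6 ℕ.* length 𝒯
      ≡⟨ cong₂ (λ f e → suc (f ℕ.+ 2 ℕ.* e) ℕ.+ 6 ℕ.* length 𝒯) #2≡f #3≡e ⟩
    suc (f ℕ.+ 2 ℕ.* e) ℕ.+ 6 ℕ.* length 𝒯
      ∎
    where
    open ≡-Reasoning
    #2 = length (filter (λ S → Subgroup.ord S ℕ.≟ 2) 𝒮)
    #3 = length (filter (λ S → Subgroup.ord S ℕ.≟ 3) 𝒮)
    1≤|𝒮| : 1 ≤ length 𝒮
    1≤|𝒮| = ℕₚ.≤-trans 1≤f (subst (_≤ length 𝒮) #2≡f (Listₚ.length-filter _ 𝒮))

  -- A member of order 3 of the spread lies in H, so Lagrange in H applies.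

  3∤d⇒e≡0 : ∀ {𝒮 f e} → HasType23 G 𝒮 f e → ¬ 3 ∣ d → e ≡ 0
  3∤d⇒e≡0 {𝒮} {e = zero}  _                3∤d = refl
  3∤d⇒e≡0 {𝒮} {e = suc e} (_ , _ , #3≡1+e) 3∤d
    with index-filter (λ S → Subgroup.ord S ℕ.≟ 3) 𝒮 (subst (1 ≤_) (sym #3≡1+e) (s≤s z≤n))
  ... | i , ord≡3 with order-3-element (lookup 𝒮 i) ord≡3
  ...   | x , _ , x≢0 , 3x≡0 = ⊥-elim (3∤d (order-3⇒3∣d 3x≡0 x≢0))

  2≤e⇒9∣d : ∀ {𝒮 f e} → IsPartialSpread G 𝒮 → HasType23 G 𝒮 f e → 2 ≤ e → 9 ∣ d
  2≤e⇒9∣d {𝒮} spread (_ , _ , #3≡e) 2≤e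
    with distinct-indices-filter (λ S → Subgroup.ord S ℕ.≟ 3) 𝒮 (subst (2 ≤_) (sym #3≡e) 2≤e)
  ... | i , j , i≢j , ordᵢ≡3 , ordⱼ≡3
    with order-3-element (lookup 𝒮 i) ordᵢ≡3 | order-3-element (lookup 𝒮 j) ordⱼ≡3
  ... | x , x∈Sᵢ , x≢0 , 3x≡0 | y , y∈Sⱼ , y≢0 , 3y≡0 = two-order-3⇒9∣d 3x≡0 x≢0 3y≡0 y∉⟨x⟩
    where
    y∉⟨x⟩ : ∀ k → y ≢ k · x
    y∉⟨x⟩ k y≡kx = y≢0 (spread i j i≢j y
      (subst (_∈ Subgroup.elems (lookup 𝒮 i)) (sym y≡kx) (·∈ (lookup 𝒮 i) k x∈Sᵢ)) y∈Sⱼ)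

-- Congruences modulo 3

infix 4 _≡₃_

_≡₃_ : ℕ → ℕ → Set
x ≡₃ y = x % 3 ≡ y % 3

≡₃-+ : ∀ {a b c d} → a ≡₃ b → c ≡₃ d → a ℕ.+ c ≡₃ b ℕ.+ d
≡₃-+ {a} {b} {c} {d} a≡₃b c≡₃d =
  trans (%-distribˡ-+ a c 3) (trans (cong₂ (λ u v → (u ℕ.+ v) % 3) a≡₃b c≡₃d) (sym (%-distribˡ-+ b d 3)))

≡₃-* : ∀ {a b c d} → a ≡₃ b → c ≡₃ d → a ℕ.* c ≡₃ b ℕ.* d
≡₃-* {a} {b} {c} {d} a≡₃b c≡₃d =
  trans (%-distribˡ-* a c 3) (trans (cong₂ (λ u v → (u ℕ.* v) % 3) a≡₃b c≡₃d) (sym (%-distribˡ-* b d 3)))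

data ParityOf (n : ℕ) : Set where
  even : n % 2 ≡ 0 → 2 ^ n ≡₃ 1 → -1ℤ ℤ.^ n ≡ 1ℤ  → ParityOf n
  odd  : n % 2 ≡ 1 → 2 ^ n ≡₃ 2 → -1ℤ ℤ.^ n ≡ -1ℤ → ParityOf n

parityOf : ∀ n → ParityOf n
parityOf zero = even refl refl refl
parityOf (suc n) with parityOf n
... | even n%2≡0 2^n≡₃1 -1^n≡1 =
  odd (trans (%-distribˡ-+ 1 n 2) (cong (λ r → (1 ℕ.+ r) % 2) n%2≡0)) (≡₃-* {2} {2} {2 ^ n} {1} refl 2^n≡₃1)
      (cong (-1ℤ ℤ.*_) -1^n≡1)
... | odd n%2≡1 2^n≡₃2 -1^n≡-1 =
  even (trans (%-distribˡ-+ 1 n 2) (cong (λ r → (1 ℕ.+ r) % 2) n%2≡1)) (≡₃-* {2} {2} {2 ^ n} {2} refl 2^n≡₃2)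
       (cong (-1ℤ ℤ.*_) -1^n≡-1)

2^n*2^n≡₃1 : ∀ {n} → ParityOf n → 2 ^ n ℕ.* 2 ^ n ≡₃ 1
2^n*2^n≡₃1 {n} (even _ 2^n≡₃1 _) = ≡₃-* {2 ^ n} {1} {2 ^ n} {1} 2^n≡₃1 2^n≡₃1
2^n*2^n≡₃1 {n} (odd  _ 2^n≡₃2 _) = ≡₃-* {2 ^ n} {2} {2 ^ n} {2} 2^n≡₃2 2^n≡₃2

%≡1⇒∣-1 : ∀ {n} x → x % suc n ≡ 1 → ℤ.+ suc n ℤD.∣ ℤ.+ x ℤ.- 1ℤ
%≡1⇒∣-1 {n} zero 0%n≡1 = ⊥-elim (0≢1 (trans (sym (m<n⇒m%n≡m {n = suc n} (s≤s z≤n))) 0%n≡1))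
  where
  0≢1 : 0 ≢ 1
  0≢1 ()
%≡1⇒∣-1 {n} (suc x) x%n≡1 = divides (suc x / suc n)
  (ℕₚ.+-cancelˡ-≡ 1 x _ (trans (m≡m%n+[m/n]*n (suc x) (suc n)) (cong (ℕ._+ (suc x / suc n) ℕ.* suc n) x%n≡1)))

%≡n⇒∣+1 : ∀ {n} x → x % suc n ≡ n → ℤ.+ suc n ℤD.∣ ℤ.+ x ℤ.- -1ℤ
%≡n⇒∣+1 {n} x x%n≡n = divides (suc (x / suc n))
  (trans (cong (ℕ._+ 1) (trans (m≡m%n+[m/n]*n x (suc n)) (cong (ℕ._+ (x / suc n) ℕ.* suc n) x%n≡n)))
         (regroup n (x / suc n)))
  where
  regroup : ∀ n q → n ℕ.+ q ℕ.* suc n ℕ.+ 1 ≡ suc q ℕ.* suc n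
  regroup = solve-∀

odd⇒%2≡1 : ∀ {x} → Odd x → x % 2 ≡ 1
odd⇒%2≡1 (k , refl) = trans (cong (λ n → suc n % 2) (ℕₚ.*-comm 2 k)) ([m+kn]%n≡m%n 1 k 2)

residue-6 : ∀ ρ → ρ < 6 → ρ % 2 ≡ 1 → (ρ % 3 ≡ 1 → ρ ≡ 1) × (ρ % 3 ≡ 2 → ρ ≡ 5)
residue-6 0 _ ()
residue-6 1 _ _ = (λ _ → refl) , (λ ())
residue-6 2 _ ()
residue-6 3 _ _ = (λ ()) , (λ ())
residue-6 4 _ ()
residue-6 5 _ _ = (λ ()) , (λ _ → refl)
residue-6 (suc (suc (suc (suc (suc (suc _)))))) (s≤s (s≤s (s≤s (s≤s (s≤s (s≤s ())))))) _

odd⇒%6 : ∀ {x} → Odd x → (x % 3 ≡ 1 → x % 6 ≡ 1) × (x % 3 ≡ 2 → x % 6 ≡ 5)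
odd⇒%6 {x} x-odd = proj₁ ρ-cases ∘ trans ρ%3≡x%3 , proj₂ ρ-cases ∘ trans ρ%3≡x%3
  where
  ρ%3≡x%3 : x % 6 % 3 ≡ x % 3
  ρ%3≡x%3 = m∣n⇒o%n%m≡o%m 3 6 x (divides 2 refl)
  ρ-cases = residue-6 (x % 6) (m%n<n x 6) (trans (m∣n⇒o%n%m≡o%m 2 6 x (divides 3 refl)) (odd⇒%2≡1 x-odd))

odd-multiple : ∀ {c x} → Odd x → c ∣ x → ∃[ j ] x ≡ c ℕ.+ j ℕ.* (2 ℕ.* c)
odd-multiple {c} (k , x≡1+2k) (divides q x≡qc) with parity q
... | j , inj₁ refl = ⊥-elim (ℕₚ.even≢odd (j ℕ.* c) k (trans (sym (ℕₚ.*-assoc 2 j c)) (trans (sym x≡qc) x≡1+2k)))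
... | j , inj₂ refl = j , trans x≡qc (regroup j c)
  where
  regroup : ∀ j c → suc (2 ℕ.* j) ℕ.* c ≡ c ℕ.+ j ℕ.* (2 ℕ.* c)
  regroup = solve-∀

2^n*[2^n*x]≡₃x : ∀ {n} → ParityOf n → ∀ x → 2 ^ n ℕ.* (2 ^ n ℕ.* x) ≡₃ x
2^n*[2^n*x]≡₃x {n} parity x = trans (cong (_% 3) (sym (ℕₚ.*-assoc (2 ^ n) (2 ^ n) x)))
  (trans (≡₃-* {2 ^ n ℕ.* 2 ^ n} {1} {x} {x} (2^n*2^n≡₃1 parity) refl) (cong (_% 3) (ℕₚ.*-identityˡ x)))

2^n*-cancel-≡₃ : ∀ {n} → ParityOf n → ∀ {x y} → 2 ^ n ℕ.* x ≡₃ 2 ^ n ℕ.* y → x ≡₃ y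
2^n*-cancel-≡₃ {n} parity {x} {y} 2^nx≡₃2^ny = trans (sym (2^n*[2^n*x]≡₃x parity x))
  (trans (≡₃-* {2 ^ n} {2 ^ n} {2 ^ n ℕ.* x} {2 ^ n ℕ.* y} refl 2^nx≡₃2^ny) (2^n*[2^n*x]≡₃x parity y))

module _ {m ℓ d e t : ℕ} (d-odd : Odd d) (order≡ : 2 ^ (m ℕ.+ ℓ) ℕ.* d ≡ 2 ^ m ℕ.+ 2 ℕ.* e ℕ.+ 6 ℕ.* t) where

  private
    order-mod-3 : 2 ^ m ℕ.* (2 ^ ℓ ℕ.* d) ≡₃ 2 ^ m ℕ.+ 2 ℕ.* e
    order-mod-3 = begin
      (2 ^ m ℕ.* (2 ^ ℓ ℕ.* d)) % 3               ≡⟨ cong (_% 3) (sym (ℕₚ.*-assoc (2 ^ m) (2 ^ ℓ) d)) ⟩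
      (2 ^ m ℕ.* 2 ^ ℓ ℕ.* d) % 3                 ≡⟨ cong (λ n → (n ℕ.* d) % 3) (sym (ℕₚ.^-distribˡ-+-* 2 m ℓ)) ⟩
      (2 ^ (m ℕ.+ ℓ) ℕ.* d) % 3                   ≡⟨ cong (_% 3) order≡ ⟩
      (2 ^ m ℕ.+ 2 ℕ.* e ℕ.+ 6 ℕ.* t) % 3
        ≡⟨ cong (λ n → (2 ^ m ℕ.+ 2 ℕ.* e ℕ.+ n) % 3) (trans (ℕₚ.*-comm 6 t) (sym (ℕₚ.*-assoc t 2 3))) ⟩
      (2 ^ m ℕ.+ 2 ℕ.* e ℕ.+ t ℕ.* 2 ℕ.* 3) % 3   ≡⟨ [m+kn]%n≡m%n (2 ^ m ℕ.+ 2 ℕ.* e) (t ℕ.* 2) 3 ⟩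
      (2 ^ m ℕ.+ 2 ℕ.* e) % 3                     ∎
      where open ≡-Reasoning

  3∣d⇒e≡₃2^m : 3 ∣ d → e ≡₃ 2 ^ m
  3∣d⇒e≡₃2^m 3∣d = begin
    e % 3                              ≡⟨ cong (_% 3) (sym (ℕₚ.+-identityʳ e)) ⟩
    (e ℕ.+ 0) % 3                      ≡⟨ ≡₃-+ {e} {e} {0} refl (sym 2^m+2e≡₃0) ⟩
    (e ℕ.+ (2 ^ m ℕ.+ 2 ℕ.* e)) % 3    ≡⟨ cong (_% 3) (regroup e (2 ^ m)) ⟩
    (2 ^ m ℕ.+ e ℕ.* 3) % 3            ≡⟨ [m+kn]%n≡m%n (2 ^ m) e 3 ⟩
    2 ^ m % 3                          ∎
    where
    open ≡-Reasoning
    regroup : ∀ e p → e ℕ.+ (p ℕ.+ 2 ℕ.* e) ≡ p ℕ.+ e ℕ.* 3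
    regroup = solve-∀
    2^m+2e≡₃0 : 2 ^ m ℕ.+ 2 ℕ.* e ≡₃ 0
    2^m+2e≡₃0 = trans (sym order-mod-3) (trans
      (≡₃-* {2 ^ m} {2 ^ m} {2 ^ ℓ ℕ.* d} {2 ^ ℓ ℕ.* 0} refl (≡₃-* {2 ^ ℓ} {2 ^ ℓ} refl (ℕ∣.n∣m⇒m%n≡0 d 3 3∣d)))
      (cong (_% 3) (trans (cong (2 ^ m ℕ.*_) (ℕₚ.*-zeroʳ (2 ^ ℓ))) (ℕₚ.*-zeroʳ (2 ^ m)))))

  e≡0⇒d≡₃2^ℓ : e ≡ 0 → d ≡₃ 2 ^ ℓ
  e≡0⇒d≡₃2^ℓ refl = trans (2^n*-cancel-≡₃ (parityOf ℓ) (trans 2^ℓd≡₃1 (sym (2^n*[2^n*x]≡₃x (parityOf ℓ) 1))))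
    (cong (_% 3) (ℕₚ.*-identityʳ (2 ^ ℓ)))
    where
    2^ℓd≡₃1 : 2 ^ ℓ ℕ.* d ≡₃ 1
    2^ℓd≡₃1 = 2^n*-cancel-≡₃ (parityOf m)
      (trans order-mod-3 (cong (_% 3) (trans (ℕₚ.+-identityʳ (2 ^ m)) (sym (ℕₚ.*-identityʳ (2 ^ m))))))

  congruence-e : 3 ∣ d → ℤ.+ 3 ℤD.∣ ℤ.+ e ℤ.- -1ℤ ℤ.^ m
  congruence-e 3∣d with parityOf m
  ... | even _ 2^m≡₃1 -1^m≡1  = subst (λ s → ℤ.+ 3 ℤD.∣ ℤ.+ e ℤ.- s) (sym -1^m≡1)
                                  (%≡1⇒∣-1 e (trans (3∣d⇒e≡₃2^m 3∣d) 2^m≡₃1))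
  ... | odd _ 2^m≡₃2 -1^m≡-1 = subst (λ s → ℤ.+ 3 ℤD.∣ ℤ.+ e ℤ.- s) (sym -1^m≡-1)
                                  (%≡n⇒∣+1 e (trans (3∣d⇒e≡₃2^m 3∣d) 2^m≡₃2))

  congruence-d : (¬ 3 ∣ d → e ≡ 0) → (2 ≤ e → 9 ∣ d) →
    ℤ.+ 6 ℤD.∣ ℤ.+ d ℤ.- -1ℤ ℤ.^ ℓ ⊎ (m % 2 ≡ 0 × d % 6 ≡ 3) ⊎ (m % 2 ≡ 1 × d % 18 ≡ 9)
  congruence-d 3∤d⇒e≡0 _ with 3 ℕ∣.∣? d
  ... | no 3∤d with parityOf ℓ
  ...   | even _ 2^ℓ≡₃1 -1^ℓ≡1  = inj₁ (subst (λ s → ℤ.+ 6 ℤD.∣ ℤ.+ d ℤ.- s) (sym -1^ℓ≡1)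
          (%≡1⇒∣-1 d (proj₁ (odd⇒%6 d-odd) (trans (e≡0⇒d≡₃2^ℓ (3∤d⇒e≡0 3∤d)) 2^ℓ≡₃1))))
  ...   | odd _ 2^ℓ≡₃2 -1^ℓ≡-1 = inj₁ (subst (λ s → ℤ.+ 6 ℤD.∣ ℤ.+ d ℤ.- s) (sym -1^ℓ≡-1)
          (%≡n⇒∣+1 d (proj₂ (odd⇒%6 d-odd) (trans (e≡0⇒d≡₃2^ℓ (3∤d⇒e≡0 3∤d)) 2^ℓ≡₃2))))
  congruence-d _ 2≤e⇒9∣d | yes 3∣d with parityOf m
  ... | even m%2≡0 _ _ with odd-multiple d-odd 3∣d
  ...   | j , d≡3+6j = inj₂ (inj₁ (m%2≡0 , trans (cong (_% 6) d≡3+6j) ([m+kn]%n≡m%n 3 j 6)))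
  congruence-d _ 2≤e⇒9∣d | yes 3∣d | odd m%2≡1 2^m≡₃2 _ with odd-multiple d-odd (2≤e⇒9∣d 2≤e)
    where
    2≤e : 2 ≤ e
    2≤e = subst (2 ≤_) (sym (trans (m≡m%n+[m/n]*n e 3) (cong (ℕ._+ (e / 3) ℕ.* 3) (trans (3∣d⇒e≡₃2^m 3∣d) 2^m≡₃2))))
                (ℕₚ.m≤m+n 2 _)
  ...   | j , d≡9+18j = inj₂ (inj₂ (m%2≡1 , trans (cong (_% 18) d≡9+18j) ([m+kn]%n≡m%n 9 j 18)))

-- Opened only now: unqualified ℕ addition and ℤ's +_ would clash with the group's _+_ above.
open import Data.Nat using (_+_; _*_)
open import Data.Integer using (+_)

lemma2p4 :
  (G : FinAbGroup) (f e : ℕ) →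
  1 ≤ f →
  FinAbGroup.numInvolutions G ≡ f →
  HasDiffFamily23 G f e →
  ∃[ m ] (1 ≤ m × f ≡ 2 ^ m ∸ 1
    × ∃[ ℓ ] ∃[ d ] (d % 2 ≡ 1 × 1 ≤ d
      × FinAbGroup.order G ≡ 2 ^ (m + ℓ) * d
      × (Σ[ H ∈ FinAbGroup ] Σ[ αs ∈ List ℕ ]
           (FinAbGroup.order H ≡ d × length αs ≡ m × All (1 ≤_) αs
            × sum αs ≡ m + ℓ × IsoToCyc2Prod G αs H))
      × (3 ∣ d → (+ 3) ℤD.∣ ((+ e) ℤ.- (-1ℤ ℤ.^ m)))
      × ((+ 6) ℤD.∣ ((+ d) ℤ.- (-1ℤ ℤ.^ ℓ))
         ⊎ (m % 2 ≡ 0 × d % 6 ≡ 3)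
         ⊎ (m % 2 ≡ 1 × d % 18 ≡ 9))))
lemma2p4 G f e 1≤f #involutions≡f (𝒮 , 𝒯 , spread , type , diffFamily) =
  m , 1≤m , cong (_∸ 1) 1+f≡2^m ,
  ℓ , d , odd⇒%2≡1 d-odd , 1≤d , order≡ ,
  (oddPart , αs , refl , Listₚ.length-map proj₁ B₀ , αs-positive , sym m+ℓ≡sum , G≅Cyc2Prod×oddPart) ,
  congruence-e {m} {ℓ} {d} {e} {length 𝒯} d-odd count ,
  congruence-d {m} {ℓ} {d} {e} {length 𝒯} d-odd count (3∤d⇒e≡0 type) (2≤e⇒9∣d spread type)
  where
  open FinAbGroupTheory G
  m = length B₀
  ℓ = sum αs ∸ m
  αs-positive : All (1 ≤_) αs
  αs-positive = positive B₀ B₀.orders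
  m+ℓ≡sum : m + ℓ ≡ sum αs
  m+ℓ≡sum = ℕₚ.m+[n∸m]≡n (subst (_≤ sum αs) (Listₚ.length-map proj₁ B₀) (length≤sum αs αs-positive))
  order≡ : FinAbGroup.order G ≡ 2 ^ (m + ℓ) * d
  order≡ = subst (λ n → FinAbGroup.order G ≡ 2 ^ n * d) (sym m+ℓ≡sum) order≡2^sum*d
  1+f≡2^m : suc f ≡ 2 ^ m
  1+f≡2^m = trans (cong suc (sym #involutions≡f)) (trans 1+numInvolutions≡#order≤2 #order≤2)
  1≤m : 1 ≤ m
  1≤m with m | 1+f≡2^m
  ... | suc _ | _     = s≤s z≤n
  ... | zero  | 1+f≡1 = ⊥-elim (ℕₚ.<⇒≢ 1≤f (sym (ℕₚ.suc-injective 1+f≡1)))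
  1≤d : 1 ≤ d
  1≤d = subst (1 ≤_) (sym (proj₂ d-odd)) (s≤s z≤n)
  count : 2 ^ (m + ℓ) * d ≡ 2 ^ m + 2 * e + 6 * length 𝒯
  count = trans (sym order≡) (trans (order≡1+f+2e+6t {𝒮} {𝒯} spread type diffFamily 1≤f)
                                     (cong (λ n → n + 2 * e + 6 * length 𝒯) 1+f≡2^m))
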